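{- Let $n\geq 7$ and let $T^{*}$ be a chemical tree on $n$ vertices. Then $ZC_{1}^{*}(T^{*})\geq ZC_{1}^{*}(T)$ for every chemical tree $T$ on $n$ vertices if and only if $T^{*}\in\mathbb{CT}_{n}^{*}$.
   Context: A chemical tree is a tree in which every vertex has degree at most $4$; a pendent vertex is a vertex of degree $1$. For a vertex $v$ of a graph $G$, $d_v$ denotes its degree and $\tau_v$ denotes the number of vertices at distance exactly $2$ from $v$. The modified first Zagreb connection index is $ZC_{1}^{*}(G)=\sum_{v\in V(G)}d_{v}\tau_{v}$. For $n\geq 7$, $\mathbb{CT}_{n}^{*}$ is the following set of $n$-vertex chemical trees: if $n\equiv 0 \pmod 3$, those in which exactly one vertex has degree $2$, this vertex has a pendent neighbor, and every other vertex has degree $1$ or $4$; if $n\equiv 1\pmod 3$, those in which exactly one vertex has degree $3$, this vertex has two pendent neighbors, and every other vertex has degree $1$ or $4$; if $n\equiv 2\pmod 3$, those in which every vertex has degree $1$ or $4$. -}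

module Defs where

open import Data.Nat using (ℕ; zero; suc; _+_; _*_; _≤_; _%_)
open import Data.Bool using (Bool; true; false; _∧_; not; if_then_else_)
open import Data.Fin using (Fin)
open import Data.Fin.Properties using (_≟_)
open import Data.List using (List; filter; length; map)
open import Data.Bool.ListAction using () renaming (any to anyᴸ)
open import Data.Nat.ListAction using (sum)
open import Data.Product using (Σ; _×_; _,_; ∃)
open import Relation.Binary.PropositionalEquality using (_≡_)
open import Relation.Nullary using (¬_)
open import Relation.Nullary.Decidable using (⌊_⌋)
open import Data.List.Base using ([]; _∷_)

allFin : (n : ℕ) → List (Fin n)
allFin n = Data.List.allFin n

record Graph (n : ℕ) : Set where
  field
    adj   : Fin n → Fin n → Bool
    sym   : ∀ u v → adj u v ≡ adj v u
    irrefl : ∀ v → adj v v ≡ false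
open Graph public

count : {n : ℕ} → (Fin n → Bool) → ℕ
count {n} p = length (filter (λ x → Relation.Nullary.Decidable.Core.T? (p x)) (allFin n))
  where import Relation.Nullary.Decidable.Core

deg : {n : ℕ} → Graph n → Fin n → ℕ
deg G v = count (adj G v)

dist2 : {n : ℕ} → Graph n → Fin n → Fin n → Bool
dist2 {n} G v w =
  not ⌊ v ≟ w ⌋ ∧ not (adj G v w) ∧ anyᴸ (λ u → adj G v u ∧ adj G u w) (allFin n)

tau : {n : ℕ} → Graph n → Fin n → ℕ
tau G v = count (dist2 G v)

ZC1* : {n : ℕ} → Graph n → ℕ
ZC1* {n} G = sum (map (λ v → deg G v * tau G v) (allFin n))

data Reach {n : ℕ} (G : Graph n) : Fin n → Fin n → Set where
  here : ∀ {v} → Reach G v v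
  step : ∀ {u v w} → adj G u v ≡ true → Reach G v w → Reach G u w

Connected : {n : ℕ} → Graph n → Set
Connected G = ∀ u v → Reach G u v

sumDeg : {n : ℕ} → Graph n → ℕ
sumDeg {n} G = sum (map (deg G) (allFin n))

-- a tree on n vertices: connected with n − 1 edges, i.e. 2|E| + 2 = 2n
IsTree : {n : ℕ} → Graph n → Set
IsTree {n} G = Connected G × sumDeg G + 2 ≡ 2 * n

IsChemical : {n : ℕ} → Graph n → Set
IsChemical G = ∀ v → deg G v ≤ 4

IsChemicalTree : {n : ℕ} → Graph n → Set
IsChemicalTree G = IsTree G × IsChemical G

Pendent : {n : ℕ} → Graph n → Fin n → Set
Pendent G v = deg G v ≡ 1

Deg14 : {n : ℕ} → Graph n → Fin n → Set
Deg14 G v = (deg G v ≡ 1) Data.Sum.⊎ (deg G v ≡ 4)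
  where import Data.Sum

InCT* : {n : ℕ} → Graph n → Set
InCT* {n} G with n % 3
... | 0 = Σ (Fin n) λ x → deg G x ≡ 2
           × (Σ (Fin n) λ y → adj G x y ≡ true × Pendent G y)
           × (∀ v → ¬ (v ≡ x) → Deg14 G v)
... | 1 = Σ (Fin n) λ x → deg G x ≡ 3
           × (Σ (Fin n) λ y → Σ (Fin n) λ z →
                ¬ (y ≡ z) × adj G x y ≡ true × adj G x z ≡ true
                × Pendent G y × Pendent G z)
           × (∀ v → ¬ (v ≡ x) → Deg14 G v)
... | _ = ∀ v → Deg14 G v

module Submission where

-- The proof is a discharging argument.  Trees have no triangles or 4-cycles
-- (via breadth-first levels and edge counting), so τ_v = Σ_{u ~ v} (d_u − 1)
-- and ZC₁* is a sum over edges.  Each vertex v gets a budget 28(d_v − 1) and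
-- spends share(d_v, d_u) on every incident edge; vertices of degree 2 or 3
-- with at most one non-pendent neighbour also receive gifts from neighbours
-- of degree 2 or 3.  Summing, ZC₁*(T) + Σ_v charge v = 10n − 38, where the
-- charge is the unspent budget.  An exhaustive evaluation over all possible
-- neighbourhoods of a vertex of degree ≤ 4 shows (using n ≥ 7) that the
-- charge is 0 at degrees 1 and 4, at least 2 at degrees 2 and 3, and exactly
-- 2 at a lone vertex of degree 2 or 3 iff it has the pendent neighbours that
-- CT*_n prescribes.  Counting degrees modulo 3, the least possible total
-- charge is 0 if n ≡ 2 (mod 3) and 2 otherwise, attained exactly on CT*_n;
-- since CT*_n is non-empty (grow K₁,₄ by attaching leaves), the theorem
-- follows by comparing total charges.

open import Defs hiding (sym)
open import Data.Nat using (ℕ; zero; suc; _+_; _*_; _∸_; _≤_; _<_; z≤n; s≤s; pred; _≤ᵇ_; _≡ᵇ_; _%_)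
open import Data.Nat.Properties hiding (_≟_; suc-injective)
open import Data.Nat.Properties using () renaming (_≟_ to _≟ℕ_)
open import Data.Nat.DivMod using ([m+kn]%n≡m%n; m%n<n)
open import Data.Nat.Solver using (module +-*-Solver)
open import Data.Nat.ListAction using (sum)
open import Data.Bool using (Bool; true; false; _∧_; _∨_; not; if_then_else_; T)
open import Data.Bool.ListAction using (or; all) renaming (any to anyᴸ)
open import Data.Fin using (Fin; zero; suc; toℕ)
open import Data.Fin.Properties using (_≟_; suc-injective)
open import Data.List using (List; []; _∷_; map; filter; tabulate; length; cartesianProduct; cartesianProductWith)
open import Data.List.Properties using (filter-accept; filter-reject; map-∘; length-map)
open import Data.List.Membership.Propositional using (_∈_)
open import Data.List.Membership.Propositional.Properties
  using (∈-cartesianProductWith⁺; ∈-cartesianProduct⁺; ∈-map⁺; ∈-filter⁺; ∈-filter⁻; ∈-allFin)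
open import Data.List.Relation.Unary.Any using (here; there)
open import Data.List.Relation.Unary.All as All using (All; []; _∷_)
open import Data.List.Relation.Unary.All.Properties using (all⁺; all⁻) renaming (map⁺ to All-map⁺)
open import Data.Product using (Σ; _×_; _,_; proj₁; proj₂)
open import Data.Sum using (_⊎_; inj₁; inj₂)
open import Data.Empty using (⊥; ⊥-elim)
open import Data.Unit using (tt)
open import Function using (_∘′_)
open import Function.Bundles using (_⇔_; mk⇔; Equivalence)
open import Relation.Binary.PropositionalEquality
open import Relation.Nullary using (¬_; yes; no)
open import Relation.Nullary.Decidable using (⌊_⌋; T?)
open import Algebra.Properties.Semiring.Sum +-*-semiring
  using (sum-syntax; ∑-distrib-+; ∑-comm; sum-cong-≗; *-distribˡ-sum; *-distribʳ-sum)
  renaming (sum to ∑)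

true≢false : true ≢ false
true≢false ()

ind : Bool → ℕ
ind true = 1
ind false = 0

ind≤1 : ∀ b → ind b ≤ 1
ind≤1 true = ≤-refl
ind≤1 false = z≤n

-- The Kronecker delta on Fin n, as a Boolean defined by structural recursion
-- (so that sums over Fin (suc n) split cleanly on it).
same : ∀ {n} → Fin n → Fin n → Bool
same zero zero = true
same zero (suc j) = false
same (suc i) zero = false
same (suc i) (suc j) = same i j

same-refl : ∀ {n} (i : Fin n) → same i i ≡ true
same-refl zero = refl
same-refl (suc i) = same-refl i

same⇒≡ : ∀ {n} {i j : Fin n} → same i j ≡ true → i ≡ j
same⇒≡ {i = zero} {zero} _ = refl
same⇒≡ {i = suc i} {suc j} e = cong suc (same⇒≡ e)

≢⇒same : ∀ {n} {i j : Fin n} → i ≢ j → same i j ≡ false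
≢⇒same {i = zero} {zero} ne = ⊥-elim (ne refl)
≢⇒same {i = zero} {suc j} _ = refl
≢⇒same {i = suc i} {zero} _ = refl
≢⇒same {i = suc i} {suc j} ne = ≢⇒same (λ e → ne (cong suc e))

same-false⇒≢ : ∀ {n} {i j : Fin n} → same i j ≡ false → i ≢ j
same-false⇒≢ {i = i} e refl = true≢false (trans (sym (same-refl i)) e)

⌊≟⌋≡same : ∀ {n} (i j : Fin n) → ⌊ i ≟ j ⌋ ≡ same i j
⌊≟⌋≡same i j with i ≟ j
... | yes refl = sym (same-refl i)
... | no ne = sym (≢⇒same ne)

∑-mono : ∀ {n} {f g : Fin n → ℕ} → (∀ i → f i ≤ g i) → ∑ f ≤ ∑ g
∑-mono {zero} _ = z≤n
∑-mono {suc n} h = +-mono-≤ (h zero) (∑-mono (λ i → h (suc i)))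

∑-const : ∀ n c → ∑[ i < n ] c ≡ n * c
∑-const zero c = refl
∑-const (suc n) c = cong (c +_) (∑-const n c)

∑-zero : ∀ n → ∑[ i < n ] 0 ≡ 0
∑-zero n = trans (∑-const n 0) (*-zeroʳ n)

∑-ones : ∀ n → ∑[ i < n ] 1 ≡ n
∑-ones n = trans (∑-const n 1) (*-identityʳ n)

∑-single : ∀ {n} (v : Fin n) (f : Fin n → ℕ) → ∑[ i < n ] (ind (same i v) * f i) ≡ f v
∑-single {suc n} zero f = trans (cong (f zero + 0 +_) (∑-zero n)) (trans (+-identityʳ _) (+-identityʳ _))
∑-single {suc n} (suc v) f = ∑-single v (λ i → f (suc i))

∑-≥-term : ∀ {n} (v : Fin n) (f : Fin n → ℕ) → f v ≤ ∑ f
∑-≥-term zero f = m≤m+n _ _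
∑-≥-term (suc v) f = ≤-trans (∑-≥-term v (λ i → f (suc i))) (m≤n+m _ _)

∑-≥-pair : ∀ {n} {x y : Fin n} (f : Fin n → ℕ) → x ≢ y → f x + f y ≤ ∑ f
∑-≥-pair {x = zero} {zero} f ne = ⊥-elim (ne refl)
∑-≥-pair {x = zero} {suc y} f ne = +-monoʳ-≤ (f zero) (∑-≥-term y (λ i → f (suc i)))
∑-≥-pair {x = suc x} {zero} f ne =
  subst (_≤ ∑ f) (+-comm (f zero) (f (suc x))) (+-monoʳ-≤ (f zero) (∑-≥-term x (λ i → f (suc i))))
∑-≥-pair {x = suc x} {suc y} f ne =
  ≤-trans (∑-≥-pair (λ i → f (suc i)) (λ e → ne (cong suc e))) (m≤n+m _ _)

∑-pos : ∀ {n} (f : Fin n → ℕ) → 1 ≤ ∑ f → Σ (Fin n) λ i → 1 ≤ f i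
∑-pos {suc n} f h with f zero in e
... | suc _ = zero , subst (1 ≤_) (sym e) (s≤s z≤n)
... | zero = let (i , p) = ∑-pos (λ i → f (suc i)) h in suc i , p

∑-two : ∀ {n} (f : Fin n → ℕ) → (∀ i → f i ≤ 1) → 2 ≤ ∑ f →
        Σ (Fin n) λ i → Σ (Fin n) λ j → i ≢ j × 1 ≤ f i × 1 ≤ f j
∑-two {suc n} f b h with f zero in e
... | zero = let (i , j , ne , p , q) = ∑-two (λ i → f (suc i)) (λ i → b (suc i)) h
             in suc i , suc j , (λ x → ne (suc-injective x)) , p , q
... | suc zero = let (j , q) = ∑-pos (λ i → f (suc i)) (≤-pred h)
                 in zero , suc j , (λ ()) , subst (1 ≤_) (sym e) (s≤s z≤n) , q
... | suc (suc _) = ⊥-elim (1+n≰n (≤-trans (s≤s (s≤s z≤n)) (subst (_≤ 1) e (b zero))))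

all-or-some : ∀ {n} {P Q : Fin n → Set} → (∀ v → P v ⊎ Q v) → (∀ v → P v) ⊎ Σ (Fin n) Q
all-or-some {zero} _ = inj₁ (λ ())
all-or-some {suc n} {P} {Q} h with h zero | all-or-some {n} {λ v → P (suc v)} {λ v → Q (suc v)} (λ v → h (suc v))
... | inj₂ q | _ = inj₂ (zero , q)
... | inj₁ _ | inj₂ (v , q) = inj₂ (suc v , q)
... | inj₁ p | inj₁ ps = inj₁ λ { zero → p ; (suc v) → ps v }

∑-allFin : ∀ n (f : Fin n → ℕ) → sum (map f (allFin n)) ≡ ∑ f
∑-allFin n f = trans (cong sum (map-tabulate n)) (sum-tabulate n (λ i → f i))
  where
  map-tabulate : ∀ m {g : Fin m → Fin n} → map f (tabulate g) ≡ tabulate (λ i → f (g i))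
  map-tabulate zero = refl
  map-tabulate (suc m) = cong (_ ∷_) (map-tabulate m)
  sum-tabulate : ∀ m (h : Fin m → ℕ) → sum (tabulate h) ≡ ∑ h
  sum-tabulate zero h = refl
  sum-tabulate (suc m) h = cong (h zero +_) (sum-tabulate m (λ i → h (suc i)))

sum-filter : ∀ {A : Set} (p : A → Bool) (F : A → ℕ) (xs : List A) →
  sum (map F (filter (λ x → T? (p x)) xs)) ≡ sum (map (λ x → ind (p x) * F x) xs)
sum-filter p F [] = refl
sum-filter p F (x ∷ xs) = byCase (p x) refl
  where
  byCase : ∀ b → p x ≡ b →
           sum (map F (filter (λ y → T? (p y)) (x ∷ xs))) ≡ ind b * F x + sum (map (λ y → ind (p y) * F y) xs)
  byCase true e = trans (cong (λ ys → sum (map F ys)) (filter-accept (λ y → T? (p y)) (subst T (sym e) tt)))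
                      (cong₂ _+_ (sym (+-identityʳ (F x))) (sum-filter p F xs))
  byCase false e = trans (cong (λ ys → sum (map F ys)) (filter-reject (λ y → T? (p y)) (subst T e)))
                       (sum-filter p F xs)

count≡∑ : ∀ {n} (p : Fin n → Bool) → count p ≡ ∑[ i < n ] ind (p i)
count≡∑ {n} p = trans (length≡sum (filter (λ x → T? (p x)) (allFin n)))
                      (trans (sum-filter p (λ _ → 1) (allFin n))
                             (trans (∑-allFin n _) (sum-cong-≗ (λ i → *-identityʳ (ind (p i))))))
  where
  length≡sum : ∀ {A : Set} (xs : List A) → length xs ≡ sum (map (λ _ → 1) xs)
  length≡sum [] = refl
  length≡sum (x ∷ xs) = cong suc (length≡sum xs)

_⇔ᵇ_ : Bool → Bool → Bool
a ⇔ᵇ b = if a then b else not b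

ind-∧ : ∀ a b → ind a * ind b ≡ ind (a ∧ b)
ind-∧ true b = +-identityʳ (ind b)
ind-∧ false b = refl

∧-split : ∀ {a b} → (a ∧ b) ≡ true → (a ≡ true) × (b ≡ true)
∧-split {true} {true} _ = refl , refl

∨-right : ∀ {a b} → (a ∨ b) ≡ true → a ≡ false → b ≡ true
∨-right {false} e _ = e

T-split : ∀ {a b} → T (a ∧ b) → T a × T b
T-split {true} {true} _ = tt , tt

T⇒≡ : ∀ {b} → T b → b ≡ true
T⇒≡ {true} _ = refl

≡⇒T : ∀ {b} → b ≡ true → T b
≡⇒T refl = tt

T-⇔ᵇ : ∀ {a b} → T (a ⇔ᵇ b) → (T a → T b) × (T b → T a)
T-⇔ᵇ {true} {true} _ = (λ _ → tt) , (λ _ → tt)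
T-⇔ᵇ {false} {false} _ = (λ ()) , (λ ())

T-∨ : ∀ {a b} → T (a ∨ b) → T a ⊎ T b
T-∨ {true} _ = inj₁ tt
T-∨ {false} t = inj₂ t


any-witness : ∀ {n} (q : Fin n → Bool) → anyᴸ q (allFin n) ≡ true → Σ (Fin n) λ x → q x ≡ true
any-witness {n} q = go n (λ i → i)
  where
  go : ∀ m (h : Fin m → Fin n) → or (map q (tabulate h)) ≡ true → Σ (Fin n) λ x → q x ≡ true
  go (suc m) h e with q (h zero) in qh
  ... | true = h zero , qh
  ... | false = go m (λ i → h (suc i)) e

any-intro : ∀ {n} (q : Fin n → Bool) (x : Fin n) → q x ≡ true → anyᴸ q (allFin n) ≡ true
any-intro {n} q x qx = go n (λ i → i) x qx
  where
  go : ∀ m (h : Fin m → Fin n) (y : Fin m) → q (h y) ≡ true → or (map q (tabulate h)) ≡ true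
  go (suc m) h zero e rewrite e = refl
  go (suc m) h (suc y) e with q (h zero)
  ... | true = refl
  ... | false = go m (λ i → h (suc i)) y e

choose-by : ∀ {n} (q : Fin n → Bool) → Fin n → (b : Bool) → anyᴸ q (allFin n) ≡ b → Fin n
choose-by q d true e = proj₁ (any-witness q e)
choose-by q d false _ = d

choose : ∀ {n} (q : Fin n → Bool) → Fin n → Fin n
choose {n} q d = choose-by q d (anyᴸ q (allFin n)) refl

choose-spec : ∀ {n} (q : Fin n → Bool) (d : Fin n) → anyᴸ q (allFin n) ≡ true → q (choose q d) ≡ true
choose-spec {n} q d = from (anyᴸ q (allFin n)) refl
  where
  from : (b : Bool) (e : anyᴸ q (allFin n) ≡ b) → b ≡ true → q (choose-by q d b e) ≡ true
  from true e _ = proj₂ (any-witness q e)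

at-most-one-witness : ∀ {n} (q : Fin n → Bool) → (∀ x y → q x ≡ true → q y ≡ true → x ≡ y) →
                      ∑[ i < n ] ind (q i) ≡ ind (anyᴸ q (allFin n))
at-most-one-witness {n} q unique with anyᴸ q (allFin n) in eq
... | true = let (x , qx) = any-witness q eq in
    trans (sum-cong-≗ (only x qx)) (∑-single x (λ _ → 1))
  where
  only : ∀ x → q x ≡ true → ∀ i → ind (q i) ≡ ind (same i x) * 1
  only x qx i with q i in qi | same i x in ei
  ... | true | true = refl
  ... | true | false = ⊥-elim (true≢false (trans (sym (trans (cong (λ z → same z x) (unique i x qi qx)) (same-refl x))) ei))
  ... | false | false = refl
  ... | false | true = ⊥-elim (true≢false (trans (sym qx) (subst (λ z → q z ≡ false) (same⇒≡ ei) qi)))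
... | false = trans (sum-cong-≗ none) (∑-zero n)
  where
  none : ∀ i → ind (q i) ≡ 0
  none i with q i in qi
  ... | false = refl
  ... | true = ⊥-elim (true≢false (trans (sym (any-intro q i qi)) eq))

module _ {n : ℕ} (G : Graph n) where

  ΣN : Fin n → (Fin n → ℕ) → ℕ
  ΣN v F = ∑[ u < n ] (ind (adj G v u) * F u)

  deg≡ΣN : ∀ v → deg G v ≡ ΣN v (λ _ → 1)
  deg≡ΣN v = trans (count≡∑ (adj G v)) (sum-cong-≗ (λ u → sym (*-identityʳ (ind (adj G v u)))))

  adj-sym : ∀ {u v} → adj G u v ≡ true → adj G v u ≡ true
  adj-sym {u} {v} e = trans (Graph.sym G v u) e

  adj⇒≢ : ∀ {u v} → adj G u v ≡ true → u ≢ v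
  adj⇒≢ {u} e refl = true≢false (trans (sym e) (irrefl G u))

  adj⇒deg≥1 : ∀ {u v} → adj G v u ≡ true → 1 ≤ deg G u
  adj⇒deg≥1 {u} {v} e = subst (1 ≤_) (sym (count≡∑ (adj G u)))
    (subst (λ b → ind b ≤ ∑[ w < n ] ind (adj G u w)) (adj-sym e) (∑-≥-term v (λ w → ind (adj G u w))))

  pendent-unique : ∀ {x y u} → deg G x ≡ 1 → adj G x y ≡ true → adj G x u ≡ true → y ≡ u
  pendent-unique {x} {y} {u} d1 e1 e2 with y ≟ u
  ... | yes p = p
  ... | no ne = ⊥-elim (1+n≰n (subst (2 ≤_) (trans (sym (count≡∑ (adj G x))) d1)
          (subst (_≤ ∑[ w < n ] ind (adj G x w)) (cong₂ (λ a b → ind a + ind b) e1 e2)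
            (∑-≥-pair (λ w → ind (adj G x w)) ne))))

  ΣN-swap : (F : Fin n → Fin n → ℕ) → ∑[ v < n ] ΣN v (F v) ≡ ∑[ v < n ] ΣN v (λ u → F u v)
  ΣN-swap F = trans (∑-comm (λ v u → ind (adj G v u) * F v u))
    (sum-cong-≗ (λ v → sum-cong-≗ (λ u → cong (λ b → ind b * F u v) (Graph.sym G u v))))

  ΣN-+ : ∀ v (f g : Fin n → ℕ) → ΣN v (λ u → f u + g u) ≡ ΣN v f + ΣN v g
  ΣN-+ v f g = trans (sum-cong-≗ (λ u → *-distribˡ-+ (ind (adj G v u)) (f u) (g u)))
    (∑-distrib-+ (λ u → ind (adj G v u) * f u) (λ u → ind (adj G v u) * g u))

  ΣN-const : ∀ v c → ΣN v (λ _ → c) ≡ deg G v * c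
  ΣN-const v c = trans (sym (*-distribʳ-sum c (λ u → ind (adj G v u)))) (cong (_* c) (sym (count≡∑ (adj G v))))

  ΣN-symmetrize : (F : Fin n → Fin n → ℕ) → ∑[ v < n ] ΣN v (λ u → F v u + F u v) ≡ 2 * ∑[ v < n ] ΣN v (F v)
  ΣN-symmetrize F = begin
      ∑[ v < n ] ΣN v (λ u → F v u + F u v)
    ≡⟨ sum-cong-≗ (λ v → ΣN-+ v (F v) (λ u → F u v)) ⟩
      ∑[ v < n ] (ΣN v (F v) + ΣN v (λ u → F u v))
    ≡⟨ ∑-distrib-+ (λ v → ΣN v (F v)) (λ v → ΣN v (λ u → F u v)) ⟩
      ΣΣ + ∑[ v < n ] ΣN v (λ u → F u v)
    ≡⟨ cong (ΣΣ +_) (sym (ΣN-swap F)) ⟩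
      ΣΣ + ΣΣ
    ≡⟨ cong (ΣΣ +_) (sym (+-identityʳ ΣΣ)) ⟩
      2 * ΣΣ
    ∎
    where
    open ≡-Reasoning
    ΣΣ : ℕ
    ΣΣ = ∑[ v < n ] ΣN v (F v)

  deg∸1 : ∀ v u → adj G u v ≡ true →
          ∑[ w < n ] (ind (adj G u w) * ind (not (same w v))) ≡ deg G u ∸ 1
  deg∸1 v u e = sym (begin
      deg G u ∸ 1
    ≡⟨ cong (_∸ 1) (trans (count≡∑ (adj G u)) (sum-cong-≗ split)) ⟩
      ∑[ w < n ] (others w + ind (same w v) * ind (adj G u w)) ∸ 1
    ≡⟨ cong (_∸ 1) (∑-distrib-+ others (λ w → ind (same w v) * ind (adj G u w))) ⟩
      (∑ others + ∑[ w < n ] (ind (same w v) * ind (adj G u w))) ∸ 1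
    ≡⟨ cong (λ z → (∑ others + z) ∸ 1) (trans (∑-single v (λ w → ind (adj G u w))) (cong ind e)) ⟩
      (∑ others + 1) ∸ 1
    ≡⟨ m+n∸n≡m _ 1 ⟩
      ∑ others
    ∎)
    where
    open ≡-Reasoning
    others : Fin n → ℕ
    others w = ind (adj G u w) * ind (not (same w v))
    split : ∀ w → ind (adj G u w) ≡ others w + ind (same w v) * ind (adj G u w)
    split w with adj G u w | same w v
    ... | true | true = refl
    ... | true | false = refl
    ... | false | true = refl
    ... | false | false = refl

  walk2 : Fin n → Fin n → Fin n → ℕ
  walk2 v u w = ind (adj G v u) * (ind (adj G u w) * ind (not (same w v)))

  walk2-count : ∀ v → ∑[ w < n ] ∑[ u < n ] walk2 v u w ≡ ΣN v (λ u → deg G u ∸ 1)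
  walk2-count v = trans (∑-comm (λ w u → walk2 v u w)) (sym (sum-cong-≗ by-middle))
    where
    by-middle : ∀ u → ind (adj G v u) * (deg G u ∸ 1) ≡ ∑[ w < n ] walk2 v u w
    by-middle u with adj G v u in e
    ... | true = trans (+-identityʳ _) (trans (sym (deg∸1 v u (adj-sym e))) (sum-cong-≗ {n} (λ w → sym (+-identityʳ _))))
    ... | false = sym (∑-zero n)

  NoTriangle : Set
  NoTriangle = ∀ a b c → adj G a b ≡ true → adj G b c ≡ true → adj G a c ≡ true → ⊥

  NoFourCycle : Set
  NoFourCycle = ∀ v u u' w → u ≢ u' → v ≢ w → adj G v u ≡ true → adj G u w ≡ true →
                adj G v u' ≡ true → adj G u' w ≡ true → ⊥

  -- Without triangles and 4-cycles, every vertex w at distance 2 from v is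
  -- reached through exactly one neighbour of v, whence τ_v = Σ_{u ~ v} (d_u − 1).
  tau-formula : NoTriangle → NoFourCycle → ∀ v → tau G v ≡ ΣN v (λ u → deg G u ∸ 1)
  tau-formula noTri noC4 v = sym (begin
      ΣN v (λ u → deg G u ∸ 1)
    ≡⟨ sym (walk2-count v) ⟩
      ∑[ w < n ] ∑[ u < n ] walk2 v u w
    ≡⟨ sum-cong-≗ paths-to ⟩
      ∑[ w < n ] ind (dist2 G v w)
    ≡⟨ sym (count≡∑ (dist2 G v)) ⟩
      tau G v
    ∎)
    where
    open ≡-Reasoning
    dist2≡ : ∀ w → dist2 G v w ≡ (not (same v w) ∧ (not (adj G v w) ∧ anyᴸ (λ u → adj G v u ∧ adj G u w) (allFin n)))
    dist2≡ w = cong (λ b → not b ∧ (not (adj G v w) ∧ anyᴸ (λ u → adj G v u ∧ adj G u w) (allFin n))) (⌊≟⌋≡same v w)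
    paths-to : ∀ w → ∑[ u < n ] walk2 v u w ≡ ind (dist2 G v w)
    paths-to w with same w v in ewv
    ... | true = trans (sum-cong-≗ {n} (λ u → trans (cong (ind (adj G v u) *_) (*-zeroʳ (ind (adj G u w))))
                                                    (*-zeroʳ (ind (adj G v u)))))
                       (trans (∑-zero n) (cong ind (sym (not-from-self (same⇒≡ ewv)))))
      where
      not-from-self : ∀ {x} → x ≡ v → dist2 G v x ≡ false
      not-from-self refl =
        trans (dist2≡ v) (cong (λ b → not b ∧ (not (adj G v v) ∧ anyᴸ (λ u → adj G v u ∧ adj G u v) (allFin n))) (same-refl v))
    ... | false = begin
        ∑[ u < n ] (ind (adj G v u) * (ind (adj G u w) * 1))
      ≡⟨ sum-cong-≗ (λ u → trans (cong (ind (adj G v u) *_) (*-identityʳ _)) (ind-∧ (adj G v u) (adj G u w))) ⟩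
        ∑[ u < n ] ind (adj G v u ∧ adj G u w)
      ≡⟨ at-most-one-witness (λ u → adj G v u ∧ adj G u w) unique-middle ⟩
        ind (anyᴸ (λ u → adj G v u ∧ adj G u w) (allFin n))
      ≡⟨ cong ind (sym (trans (dist2≡ w) (not-adjacent (same v w) (adj G v w) _ (≢⇒same (w≢v ∘′ sym)) no-shortcut))) ⟩
        ind (dist2 G v w)
      ∎
      where
      w≢v : w ≢ v
      w≢v = same-false⇒≢ ewv
      unique-middle : ∀ x y → (adj G v x ∧ adj G x w) ≡ true → (adj G v y ∧ adj G y w) ≡ true → x ≡ y
      unique-middle x y ex ey with x ≟ y
      ... | yes p = p
      ... | no ne = let (a1 , a2) = ∧-split ex ; (b1 , b2) = ∧-split ey in
                    ⊥-elim (noC4 v x y w ne (w≢v ∘′ sym) a1 a2 b1 b2)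
      no-shortcut : anyᴸ (λ u → adj G v u ∧ adj G u w) (allFin n) ≡ true → adj G v w ≡ false
      no-shortcut ea with any-witness _ ea
      ... | (u , eu) with ∧-split eu | adj G v w in e
      ...   | _ | false = refl
      ...   | (a1 , a2) | true = ⊥-elim (noTri v u w a1 a2 e)
      not-adjacent : ∀ a b c → a ≡ false → (c ≡ true → b ≡ false) → (not a ∧ (not b ∧ c)) ≡ c
      not-adjacent false true false _ _ = refl
      not-adjacent false false false _ _ = refl
      not-adjacent false b true _ h rewrite h refl = refl

  -- If every vertex two steps away from v is pendent, a connected graph is
  -- its 2-ball around v, which has at most 1 + Σ_{u ~ v} d_u vertices.
  ball-bound : Connected G → ∀ v → (∀ u w → adj G v u ≡ true → adj G u w ≡ true → w ≢ v → deg G w ≡ 1) →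
               n ≤ 1 + ΣN v (deg G)
  ball-bound conn v far-pendent = subst (n ≤_) cover-total
    (subst (_≤ ∑ cover) (∑-ones n) (∑-mono (λ w → in-ball⇒covered w (closed (inj₁ refl) (conn v w)))))
    where
    open ≡-Reasoning
    InBall : Fin n → Set
    InBall w = (w ≡ v) ⊎ ((adj G v w ≡ true) ⊎ (Σ (Fin n) λ u → (adj G v u ≡ true) × (adj G u w ≡ true) × (w ≢ v)))
    cover : Fin n → ℕ
    cover w = (ind (same w v) + ind (adj G v w)) + ∑[ u < n ] walk2 v u w
    in-ball⇒covered : ∀ w → InBall w → 1 ≤ cover w
    in-ball⇒covered w (inj₁ refl) rewrite same-refl w = s≤s z≤n
    in-ball⇒covered w (inj₂ (inj₁ e)) rewrite e = ≤-trans (m≤n+m 1 (ind (same w v))) (m≤m+n _ _)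
    in-ball⇒covered w (inj₂ (inj₂ (u , a1 , a2 , ne))) =
      ≤-trans (≤-trans through-u (∑-≥-term u (λ u' → walk2 v u' w))) (m≤n+m _ _)
      where
      through-u : 1 ≤ walk2 v u w
      through-u rewrite a1 | a2 | ≢⇒same ne = s≤s z≤n
    extend : ∀ {x y} → InBall x → adj G x y ≡ true → InBall y
    extend (inj₁ refl) e = inj₂ (inj₁ e)
    extend {x} {y} (inj₂ (inj₁ a)) e with y ≟ v
    ... | yes p = inj₁ p
    ... | no ne = inj₂ (inj₂ (x , a , e , ne))
    extend {x} {y} (inj₂ (inj₂ (u , a1 , a2 , ne))) e =
      inj₂ (inj₁ (subst (λ z → adj G v z ≡ true) (sym (pendent-unique (far-pendent u x a1 a2 ne) e (adj-sym a2))) a1))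
    closed : ∀ {x w} → InBall x → Reach G x w → InBall w
    closed p here = p
    closed p (step e r) = closed (extend p e) r
    cover-total : ∑ cover ≡ 1 + ΣN v (deg G)
    cover-total = begin
        ∑ cover
      ≡⟨ ∑-distrib-+ (λ w → ind (same w v) + ind (adj G v w)) (λ w → ∑[ u < n ] walk2 v u w) ⟩
        ∑[ w < n ] (ind (same w v) + ind (adj G v w)) + ∑[ w < n ] ∑[ u < n ] walk2 v u w
      ≡⟨ cong₂ _+_ (∑-distrib-+ (λ w → ind (same w v)) (λ w → ind (adj G v w))) (walk2-count v) ⟩
        (∑[ w < n ] ind (same w v) + ∑[ w < n ] ind (adj G v w)) + ΣN v (λ u → deg G u ∸ 1)
      ≡⟨ cong (λ z → (z + ∑[ w < n ] ind (adj G v w)) + ΣN v (λ u → deg G u ∸ 1))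
              (trans (sum-cong-≗ {n} (λ w → sym (*-identityʳ _))) (∑-single v (λ _ → 1))) ⟩
        (1 + ∑[ w < n ] ind (adj G v w)) + ΣN v (λ u → deg G u ∸ 1)
      ≡⟨ cong (λ z → (1 + z) + ΣN v (λ u → deg G u ∸ 1)) (trans (sym (count≡∑ (adj G v))) (deg≡ΣN v)) ⟩
        (1 + ΣN v (λ _ → 1)) + ΣN v (λ u → deg G u ∸ 1)
      ≡⟨ +-assoc 1 (ΣN v (λ _ → 1)) (ΣN v (λ u → deg G u ∸ 1)) ⟩
        1 + (ΣN v (λ _ → 1) + ΣN v (λ u → deg G u ∸ 1))
      ≡⟨ cong (1 +_) (sym (∑-distrib-+ (λ u → ind (adj G v u) * 1) (λ u → ind (adj G v u) * (deg G u ∸ 1)))) ⟩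
        1 + ∑[ u < n ] (ind (adj G v u) * 1 + ind (adj G v u) * (deg G u ∸ 1))
      ≡⟨ cong (1 +_) (sum-cong-≗ recombine) ⟩
        1 + ΣN v (deg G)
      ∎
      where
      recombine : ∀ u → ind (adj G v u) * 1 + ind (adj G v u) * (deg G u ∸ 1) ≡ ind (adj G v u) * deg G u
      recombine u with adj G v u in e
      ... | true = trans (cong (1 +_) (+-identityʳ _)) (trans (m+[n∸m]≡n (adj⇒deg≥1 e)) (sym (+-identityʳ _)))
      ... | false = refl

zagreb-edge-sum : ∀ {n} (G : Graph n) → NoTriangle G → NoFourCycle G →
                  ZC1* G ≡ ∑[ v < n ] ΣN G v (λ u → deg G v * (deg G u ∸ 1))
zagreb-edge-sum {n} G noTri noC4 = trans (∑-allFin n (λ v → deg G v * tau G v)) (sum-cong-≗ per-vertex)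
  where
  per-vertex : ∀ v → deg G v * tau G v ≡ ΣN G v (λ u → deg G v * (deg G u ∸ 1))
  per-vertex v = trans (cong (deg G v *_) (tau-formula G noTri noC4 v))
    (trans (*-distribˡ-sum (deg G v) (λ u → ind (adj G v u) * (deg G u ∸ 1)))
           (sum-cong-≗ (λ u → trans (sym (*-assoc (deg G v) (ind (adj G v u)) _))
                          (trans (cong (_* (deg G u ∸ 1)) (*-comm (deg G v) (ind (adj G v u))))
                                 (*-assoc (ind (adj G v u)) (deg G v) _)))))

-- In a connected graph with at least two vertices no vertex is isolated:
-- a walk to any other vertex starts with an edge.
connected⇒deg≥1 : ∀ {n} (G : Graph n) → Connected G → 2 ≤ n → ∀ v → 1 ≤ deg G v
connected⇒deg≥1 {suc zero} G conn (s≤s ()) v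
connected⇒deg≥1 {suc (suc m)} G conn _ v = first-step (conn v (other v)) (other≢ v)
  where
  other : Fin (suc (suc m)) → Fin (suc (suc m))
  other zero = suc zero
  other (suc _) = zero
  other≢ : ∀ v → other v ≢ v
  other≢ zero ()
  other≢ (suc _) ()
  first-step : ∀ {u w} → Reach G u w → w ≢ u → 1 ≤ deg G u
  first-step here ne = ⊥-elim (ne refl)
  first-step (step e _) _ = adj⇒deg≥1 G (adj-sym G e)

least : (ℕ → Bool) → ℕ → ℕ → ℕ
least f k zero = k
least f k (suc m) = if f k then k else least f (suc k) m

least-sound : ∀ (f : ℕ → Bool) k m → f (k + m) ≡ true → f (least f k m) ≡ true
least-sound f k zero e = subst (λ z → f z ≡ true) (+-identityʳ k) e
least-sound f k (suc m) e with f k in fk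
... | true = fk
... | false = least-sound f (suc k) m (subst (λ z → f z ≡ true) (+-suc k m) e)

least-minimal : ∀ (f : ℕ → Bool) k m j → k ≤ j → j < least f k m → f j ≡ false
least-minimal f k zero j kj jl = ⊥-elim (<⇒≱ jl kj)
least-minimal f k (suc m) j kj jl with f k in fk
... | true = ⊥-elim (<⇒≱ jl kj)
... | false with k ≟ℕ j
...   | yes refl = fk
...   | no ne = least-minimal f (suc k) m j (≤∧≢⇒< kj ne) jl

module BFS {n : ℕ} (G : Graph n) (conn : Connected G) (r : Fin n) where

  within : ℕ → Fin n → Bool
  within zero w = same w r
  within (suc k) w = within k w ∨ anyᴸ (λ u → within k u ∧ adj G u w) (allFin n)

  within-step : ∀ k u w → within k u ≡ true → adj G u w ≡ true → within (suc k) w ≡ true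
  within-step k u w e1 e2 with within k w
  ... | true = refl
  ... | false = any-intro (λ u' → within k u' ∧ adj G u' w) u (cong₂ _∧_ e1 e2)

  within-mono : ∀ k j w → within k w ≡ true → within (k + j) w ≡ true
  within-mono k zero w e = subst (λ z → within z w ≡ true) (sym (+-identityʳ k)) e
  within-mono k (suc j) w e with within-mono k j w e
  ... | e' = subst (λ z → within z w ≡ true) (sym (+-suc k j)) (within-or (k + j) e')
    where
    within-or : ∀ i → within i w ≡ true → within (suc i) w ≡ true
    within-or i p rewrite p = refl

  walk-shift : ∀ {u w} → Reach G u w → Σ ℕ λ j → ∀ k → within k u ≡ true → within (k + j) w ≡ true
  walk-shift here = 0 , λ k e → subst (λ z → within z _ ≡ true) (sym (+-identityʳ k)) e
  walk-shift (step {u} {v} {w} e p) = let (j , h) = walk-shift p in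
    suc j , λ k ek → subst (λ z → within z w ≡ true) (sym (+-suc k j)) (h (suc k) (within-step k u v ek e))

  -- every vertex is within the (crude) bound `horizon` of the root
  horizon : ℕ
  horizon = ∑[ w < n ] proj₁ (walk-shift (conn r w))

  within-horizon : ∀ w → within horizon w ≡ true
  within-horizon w = subst (λ z → within z w ≡ true) (m+[n∸m]≡n (∑-≥-term w j))
    (within-mono (j w) (horizon ∸ j w) w (proj₂ (walk-shift (conn r w)) 0 (same-refl r)))
    where
    j : Fin n → ℕ
    j w = proj₁ (walk-shift (conn r w))

  level : Fin n → ℕ
  level w = least (λ k → within k w) 0 horizon

  level-sound : ∀ w → within (level w) w ≡ true
  level-sound w = least-sound (λ k → within k w) 0 horizon (within-horizon w)

  level-minimal : ∀ w j → j < level w → within j w ≡ false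
  level-minimal w j jl = least-minimal (λ k → within k w) 0 horizon j z≤n jl

  -- a neighbour one level closer to the root (the root is its own parent)
  closer : Fin n → Fin n → Bool
  closer w u = within (pred (level w)) u ∧ adj G u w

  parent : Fin n → Fin n
  parent w = choose (closer w) r

  parent-spec : ∀ w → w ≢ r → (adj G (parent w) w ≡ true) × (level (parent w) < level w)
  parent-spec w w≢r = go (level w) refl
    where
    go : ∀ l → level w ≡ l → (adj G (parent w) w ≡ true) × (level (parent w) < level w)
    go zero e = ⊥-elim (w≢r (same⇒≡ (subst (λ z → within z w ≡ true) e (level-sound w))))
    -- w is within p + 1 steps but not within p, so a neighbour within p
    -- steps exists; the chosen one has level ≤ p
    go (suc p) e =
      let reached = subst (λ z → within z w ≡ true) e (level-sound w)
          not-before = level-minimal w p (subst (p <_) (sym e) ≤-refl)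
          some-closer = ∨-right reached not-before
          (c1 , c2) = ∧-split (choose-spec (closer w) r (subst (λ z → anyᴸ (λ u → within (pred z) u ∧ adj G u w) (allFin n) ≡ true) (sym e) some-closer))
          c1' = subst (λ z → within (pred z) (parent w) ≡ true) e c1
          lp : level (parent w) ≤ p
          lp = ≮⇒≥ (λ lt → true≢false (trans (sym c1') (level-minimal (parent w) p lt)))
      in c2 , subst (level (parent w) <_) (sym e) (s≤s lp)

  -- Edge counting in the search tree: every non-root vertex owns the edge to
  -- its parent, and these n − 1 edges are distinct.
  nonroot : Fin n → ℕ
  nonroot v = ind (not (same v r))

  up : Fin n → Fin n → ℕ
  up v w = nonroot v * ind (same w (parent v))

  children : Fin n → ℕ
  children v = ∑[ w < n ] up w v

  tree-edge : Fin n → Fin n → ℕ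
  tree-edge v w = up v w + up w v

  up-total : ∀ v → ∑ (up v) ≡ nonroot v
  up-total v = trans (sym (*-distribˡ-sum (nonroot v) (λ w → ind (same w (parent v)))))
     (trans (cong (nonroot v *_) (trans (sum-cong-≗ {n} (λ w → sym (*-identityʳ _))) (∑-single (parent v) (λ _ → 1)))) (*-identityʳ _))

  tree-edges-at : ∀ v → ∑ (tree-edge v) ≡ nonroot v + children v
  tree-edges-at v = trans (∑-distrib-+ (up v) (λ w → up w v)) (cong (_+ children v) (up-total v))

  nonroot-total : ∑ nonroot + 1 ≡ n
  nonroot-total = trans (cong (∑ nonroot +_) (sym (∑-single r (λ _ → 1))))
    (trans (sym (∑-distrib-+ nonroot (λ i → ind (same i r) * 1))) (trans (sum-cong-≗ one) (∑-ones n)))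
    where
    one : ∀ i → nonroot i + ind (same i r) * 1 ≡ 1
    one i with same i r
    ... | true = refl
    ... | false = refl

  children-total : ∑ children ≡ ∑ nonroot
  children-total = trans (∑-comm (λ v w → up w v)) (sum-cong-≗ up-total)

  up-cases : ∀ v w → (up v w ≡ 0) ⊎ (v ≢ r × w ≡ parent v × up v w ≡ 1)
  up-cases v w with same v r in evr | same w (parent v) in ew
  ... | true | _ = inj₁ refl
  ... | false | false = inj₁ refl
  ... | false | true = inj₂ (same-false⇒≢ evr , same⇒≡ ew , refl)

  tree-edge≤adj : ∀ v w → tree-edge v w ≤ ind (adj G v w)
  tree-edge≤adj v w with up-cases v w | up-cases w v
  ... | inj₁ a | inj₁ b rewrite a | b = z≤n
  ... | inj₂ (vr , refl , a) | inj₁ b rewrite a | b | adj-sym G (proj₁ (parent-spec v vr)) = ≤-refl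
  ... | inj₁ a | inj₂ (wr , refl , b) rewrite a | b | proj₁ (parent-spec w wr) = ≤-refl
  ... | inj₂ (vr , refl , _) | inj₂ (wr , e , _) =
        ⊥-elim (<-asym (proj₂ (parent-spec v vr)) (subst (λ z → level z < level (parent v)) (sym e) (proj₂ (parent-spec (parent v) wr))))

  with-extra : ∀ {v} z → adj G v z ≡ true → tree-edge v z ≡ 0 → ∀ w → tree-edge v w + ind (same w z) * 1 ≤ ind (adj G v w)
  with-extra {v} z vz tz w with same w z in e
  ... | false = subst (_≤ ind (adj G v w)) (sym (+-identityʳ _)) (tree-edge≤adj v w)
  ... | true with same⇒≡ {i = w} e
  ...   | refl rewrite tz | vz = ≤-refl

  -- If m had two distinct neighbours of level ≤ level m, one of them would be
  -- neither its parent nor its child, giving an nth edge.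
  no-two-upper : IsTree G → ∀ m x y → x ≢ y → adj G m x ≡ true → adj G m y ≡ true →
                 level x ≤ level m → level y ≤ level m → ⊥
  no-two-upper (_ , sumdeg) m x y x≢y mx my lx ly = 1+n≰n (begin-strict
      2 * ∑ nonroot + 1 + 1
    ≡⟨ cong (_+ 1) (sym counted) ⟩
      ∑[ v < n ] (nonroot v + children v + ind (same v m)) + 1
    <⟨ +-mono-≤-< (∑-mono degree-bound) (n<1+n 1) ⟩
      ∑ (deg G) + 2
    ≡⟨ trans (cong (_+ 2) (sym (∑-allFin n (deg G)))) sumdeg ⟩
      2 * n
    ≡⟨ cong (2 *_) (sym nonroot-total) ⟩
      2 * (∑ nonroot + 1)
    ≡⟨ *-distribˡ-+ 2 (∑ nonroot) 1 ⟩
      2 * ∑ nonroot + 2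
    ≡⟨ +-assoc (2 * ∑ nonroot) 1 1 ⟨
      2 * ∑ nonroot + 1 + 1
    ∎)
    where
    open ≤-Reasoning
    extra-edge : ∀ z → adj G m z ≡ true → level z ≤ level m → z ≢ parent m → tree-edge m z ≡ 0
    extra-edge z _ lz z≢pm with up-cases m z | up-cases z m
    ... | inj₂ (_ , e , _) | _ = ⊥-elim (z≢pm e)
    ... | inj₁ a | inj₂ (zr , e , _) = ⊥-elim (<-irrefl refl (≤-trans (subst (λ t → suc (level t) ≤ level z) (sym e) (proj₂ (parent-spec z zr))) lz))
    ... | inj₁ a | inj₁ b = cong₂ _+_ a b
    extra : Σ (Fin n) λ z → adj G m z ≡ true × tree-edge m z ≡ 0
    extra with x ≟ parent m
    ... | yes e = y , my , extra-edge y my ly (λ e' → x≢y (trans e (sym e')))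
    ... | no ne = x , mx , extra-edge x mx lx ne
    degree-bound : ∀ v → nonroot v + children v + ind (same v m) ≤ deg G v
    degree-bound v with same v m in e
    ... | false = subst₂ _≤_ (trans (tree-edges-at v) (sym (+-identityʳ _))) (sym (count≡∑ (adj G v))) (∑-mono (tree-edge≤adj v))
    ... | true with same⇒≡ {i = v} e
    ...   | refl = let (z , mz , tz) = extra in
        subst₂ _≤_ (trans (∑-distrib-+ (tree-edge v) (λ w → ind (same w z) * 1))
                          (cong₂ _+_ (tree-edges-at v) (∑-single z (λ _ → 1))))
                   (sym (count≡∑ (adj G v)))
                   (∑-mono (with-extra z mz tz))
    counted : ∑[ v < n ] (nonroot v + children v + ind (same v m)) ≡ 2 * ∑ nonroot + 1
    counted = trans (∑-distrib-+ (λ v → nonroot v + children v) (λ v → ind (same v m)))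
      (cong₂ _+_ (trans (∑-distrib-+ nonroot children) (trans (cong (∑ nonroot +_) children-total)
                   (cong (∑ nonroot +_) (sym (+-identityʳ _)))))
                 (trans (sum-cong-≗ {n} (λ v → sym (*-identityʳ _))) (∑-single m (λ _ → 1))))

-- Trees have no triangles and no 4-cycles: on such a cycle, a vertex of
-- maximal BFS level (from any root) would have two distinct neighbours of
-- level at most its own.
module _ {n : ℕ} {G : Graph n} (T : IsTree G) (r : Fin n) where
  open BFS G (proj₁ T) r

  triangle-free-from : NoTriangle G
  triangle-free-from a b c ab bc ac with ≤-total (level a) (level b) | ≤-total (level b) (level c) | ≤-total (level a) (level c)
  ... | inj₁ a≤b | inj₂ c≤b | _ = no-two-upper T b a c (adj⇒≢ G ac) (adj-sym G ab) bc a≤b c≤b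
  ... | inj₁ a≤b | inj₁ b≤c | _ = no-two-upper T c a b (adj⇒≢ G ab) (adj-sym G ac) (adj-sym G bc) (≤-trans a≤b b≤c) b≤c
  ... | inj₂ b≤a | _ | inj₂ c≤a = no-two-upper T a b c (adj⇒≢ G bc) ab ac b≤a c≤a
  ... | inj₂ b≤a | _ | inj₁ a≤c = no-two-upper T c a b (adj⇒≢ G ab) (adj-sym G ac) (adj-sym G bc) a≤c (≤-trans b≤a a≤c)

  -- In a 4-cycle v u w u', let p be the higher of v, w and q the higher of u, u';
  -- the higher of p and q has both of its cycle neighbours below it.
  four-cycle-free-from : NoFourCycle G
  four-cycle-free-from v u u' w u≢u' v≢w vu uw vu' u'w with higher-of-vw | higher-of-uu'
    where
    higher-of-vw : Σ (Fin n) λ p → adj G p u ≡ true × adj G p u' ≡ true × level v ≤ level p × level w ≤ level p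
    higher-of-vw with ≤-total (level v) (level w)
    ... | inj₁ l = w , adj-sym G uw , adj-sym G u'w , l , ≤-refl
    ... | inj₂ l = v , vu , vu' , ≤-refl , l
    higher-of-uu' : Σ (Fin n) λ q → adj G q v ≡ true × adj G q w ≡ true × level u ≤ level q × level u' ≤ level q
    higher-of-uu' with ≤-total (level u) (level u')
    ... | inj₁ l = u' , adj-sym G vu' , u'w , l , ≤-refl
    ... | inj₂ l = u , adj-sym G vu , uw , ≤-refl , l
  ... | (p , pu , pu' , lv , lw) | (q , qv , qw , lu , lu') with ≤-total (level q) (level p)
  ...   | inj₁ q≤p = no-two-upper T p u u' u≢u' pu pu' (≤-trans lu q≤p) (≤-trans lu' q≤p)
  ...   | inj₂ p≤q = no-two-upper T q v w v≢w qv qw (≤-trans lv p≤q) (≤-trans lw p≤q)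

tree-no-triangle : ∀ {n} {G : Graph n} → IsTree G → NoTriangle G
tree-no-triangle T a = triangle-free-from T a a

tree-no-four-cycle : ∀ {n} {G : Graph n} → IsTree G → NoFourCycle G
tree-no-four-cycle T v = four-cycle-free-from T v v

-- Split the weight a(b−1) + b(a−1) of an edge
-- between endpoints of degrees a and b as share a b + share b a − 18 (each
-- vertex thus pays 9 per incident edge on top).  A vertex of degree 2 or 3
-- with at most one non-pendent neighbour ("saturated") additionally receives
-- gift g r from each neighbour of degree g ∈ {2,3}, r being its own degree.
share : ℕ → ℕ → ℕ
share 1 1 = 9
share 1 _ = 0
share 2 1 = 19
share 2 2 = 11
share 2 3 = 9
share 2 _ = 7
share 3 1 = 20
share 3 2 = 16
share 3 3 = 15
share 3 _ = 14
share _ _ = 21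

gift : ℕ → ℕ → ℕ
gift 2 2 = 4
gift 2 3 = 2
gift 3 2 = 2
gift 3 3 = 1
gift _ _ = 0

pay : ℕ → ℕ → Bool → ℕ
pay g r s = if s then gift g r else 0

degree : Fin 4 → ℕ
degree i = suc (toℕ i)

degree-onto : ∀ b → 1 ≤ b → b ≤ 4 → Σ (Fin 4) λ i → b ≡ degree i
degree-onto 1 _ _ = zero , refl
degree-onto 2 _ _ = suc zero , refl
degree-onto 3 _ _ = suc (suc zero) , refl
degree-onto 4 _ _ = suc (suc (suc zero)) , refl
degree-onto (suc (suc (suc (suc (suc _))))) _ (s≤s (s≤s (s≤s (s≤s ()))))

share-split : ∀ a b → 1 ≤ a → a ≤ 4 → 1 ≤ b → b ≤ 4 → share a b + share b a ≡ a * (b ∸ 1) + b * (a ∸ 1) + 18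
share-split a b a≥1 a≤4 b≥1 b≤4 with degree-onto a a≥1 a≤4 | degree-onto b b≥1 b≤4
... | i , refl | j , refl = table i j
  where
  table : ∀ i j → share (degree i) (degree j) + share (degree j) (degree i)
                  ≡ degree i * (degree j ∸ 1) + degree j * (degree i ∸ 1) + 18
  table zero zero = refl
  table zero (suc zero) = refl
  table zero (suc (suc zero)) = refl
  table zero (suc (suc (suc zero))) = refl
  table (suc zero) zero = refl
  table (suc zero) (suc zero) = refl
  table (suc zero) (suc (suc zero)) = refl
  table (suc zero) (suc (suc (suc zero))) = refl
  table (suc (suc zero)) zero = refl
  table (suc (suc zero)) (suc zero) = refl
  table (suc (suc zero)) (suc (suc zero)) = refl
  table (suc (suc zero)) (suc (suc (suc zero))) = refl
  table (suc (suc (suc zero))) zero = refl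
  table (suc (suc (suc zero))) (suc zero) = refl
  table (suc (suc (suc zero))) (suc (suc zero)) = refl
  table (suc (suc (suc zero))) (suc (suc (suc zero))) = refl

-- The local balance at a vertex depends only on its degree k and on the list
-- of (degree, saturated?) pairs of its neighbours.
NbrType : Set
NbrType = ℕ × Bool

isLeaf : ℕ → Bool
isLeaf b = b ≡ᵇ 1

is14 : ℕ → Bool
is14 b = (b ≡ᵇ 1) ∨ (b ≡ᵇ 4)

fairness : (k sp bu : ℕ) (a14 sat : Bool) → Bool
fairness k sp bu a14 sat = (sp ≤ᵇ bu) ∧
  (if is14 k then bu ∸ sp ≡ᵇ 0 else (2 ≤ᵇ bu ∸ sp) ∧ (not a14 ∨ ((bu ∸ sp ≤ᵇ 2) ⇔ᵇ sat)))

module Star (k : ℕ) (c : List NbrType) where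
  leaves : ℕ
  leaves = sum (map (λ p → ind (isLeaf (proj₁ p))) c)

  -- at most one non-pendent neighbour
  saturated : Bool
  saturated = k ≤ᵇ leaves + 1

  spend : ℕ
  spend = sum (map (λ p → share k (proj₁ p) + pay k (proj₁ p) (proj₂ p)) c)

  budget : ℕ
  budget = 28 * (k ∸ 1) + sum (map (λ p → pay (proj₁ p) k saturated) c)

  -- every neighbour is pendent or saturated, and the 2-ball has ≤ 6 vertices:
  -- then the whole (connected) graph has at most 6 vertices
  tiny : Bool
  tiny = all (λ p → isLeaf (proj₁ p) ∨ (proj₂ p ∧ (2 ≤ᵇ k))) c ∧ (1 + sum (map proj₁ c) ≤ᵇ 6)

  balanced : Bool
  balanced = tiny ∨ fairness k spend budget (all (λ p → is14 (proj₁ p)) c) saturated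

nbrTypes : List NbrType
nbrTypes = cartesianProduct (1 ∷ 2 ∷ 3 ∷ 4 ∷ []) (true ∷ false ∷ [])

stars : ℕ → List (List NbrType)
stars zero = [] ∷ []
stars (suc k) = cartesianProductWith _∷_ nbrTypes (stars k)

ChemicalType : NbrType → Set
ChemicalType p = 1 ≤ proj₁ p × proj₁ p ≤ 4

stars-complete : ∀ c → All ChemicalType c → c ∈ stars (length c)
stars-complete [] [] = here refl
stars-complete (p ∷ c) (ok ∷ oks) = ∈-cartesianProductWith⁺ _∷_ (type-listed p ok) (stars-complete c oks)
  where
  type-listed : ∀ p → ChemicalType p → p ∈ nbrTypes
  type-listed (b , s) (b≥1 , b≤4) with degree-onto b b≥1 b≤4
  ... | i , refl = ∈-cartesianProduct⁺ (degree-listed i) (flag-listed s)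
    where
    degree-listed : ∀ i → degree i ∈ (1 ∷ 2 ∷ 3 ∷ 4 ∷ [])
    degree-listed zero = here refl
    degree-listed (suc zero) = there (here refl)
    degree-listed (suc (suc zero)) = there (there (here refl))
    degree-listed (suc (suc (suc zero))) = there (there (there (here refl)))
    flag-listed : ∀ s → s ∈ (true ∷ false ∷ [])
    flag-listed true = here refl
    flag-listed false = there (here refl)

-- The finite check behind the whole proof: every star of degree ≤ 4 is
-- balanced (verified by evaluation over the 4681 stars).
stars-balanced : ∀ k → k ≤ 4 → T (all (Star.balanced k) (stars k))
stars-balanced 0 _ = tt
stars-balanced 1 _ = tt
stars-balanced 2 _ = tt
stars-balanced 3 _ = tt
stars-balanced 4 _ = tt
stars-balanced (suc (suc (suc (suc (suc _))))) (s≤s (s≤s (s≤s (s≤s ()))))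

star-balanced : ∀ c → length c ≤ 4 → All ChemicalType c → T (Star.balanced (length c) c)
star-balanced c len types =
  All.lookup (all⁺ (Star.balanced (length c)) (stars (length c)) (stars-balanced (length c) len)) (stars-complete c types)

module Fair {k sp bu : ℕ} {a14 sat : Bool} (fair : T (fairness k sp bu a14 sat)) where

  spend≤budget : sp ≤ bu
  spend≤budget = ≤ᵇ⇒≤ sp bu (proj₁ (T-split fair))

  regular : is14 k ≡ true → bu ∸ sp ≡ 0
  regular e with proj₂ (T-split {sp ≤ᵇ bu} fair)
  ... | t rewrite e = ≡ᵇ⇒≡ (bu ∸ sp) 0 t

  private
    exceptional-part : is14 k ≡ false → T ((2 ≤ᵇ bu ∸ sp) ∧ (not a14 ∨ ((bu ∸ sp ≤ᵇ 2) ⇔ᵇ sat)))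
    exceptional-part e with proj₂ (T-split {sp ≤ᵇ bu} fair)
    ... | t rewrite e = t

  exceptional : is14 k ≡ false → 2 ≤ bu ∸ sp
  exceptional e = ≤ᵇ⇒≤ 2 (bu ∸ sp) (proj₁ (T-split (exceptional-part e)))

  lone : is14 k ≡ false → a14 ≡ true → (bu ∸ sp ≤ 2 ⇔ sat ≡ true)
  lone e refl with T-⇔ᵇ {bu ∸ sp ≤ᵇ 2} (proj₂ (T-split {2 ≤ᵇ bu ∸ sp} (exceptional-part e)))
  ... | (to , from) = mk⇔ (λ le → T⇒≡ (to (≤⇒≤ᵇ le))) (λ st → ≤ᵇ⇒≤ _ 2 (from (≡⇒T st)))

module _ {n : ℕ} (G : Graph n) where

  leafNbrs : Fin n → ℕ
  leafNbrs v = ΣN G v (λ u → ind (isLeaf (deg G u)))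

  saturated : Fin n → Bool
  saturated v = deg G v ≤ᵇ leafNbrs v + 1

  spend : Fin n → ℕ
  spend v = ΣN G v (λ u → share (deg G v) (deg G u) + pay (deg G v) (deg G u) (saturated u))

  received : Fin n → ℕ
  received v = ΣN G v (λ u → pay (deg G u) (deg G v) (saturated v))

  budget : Fin n → ℕ
  budget v = 28 * (deg G v ∸ 1) + received v

  charge : Fin n → ℕ
  charge v = budget v ∸ spend v

  total-charge : ℕ
  total-charge = ∑ charge

  nbrs : Fin n → List (Fin n)
  nbrs v = filter (λ u → T? (adj G v u)) (allFin n)

  star : Fin n → List NbrType
  star v = map (λ u → deg G u , saturated u) (nbrs v)

  ∈-nbrs : ∀ {v u} → u ∈ nbrs v → adj G v u ≡ true
  ∈-nbrs {v} m = T⇒≡ (proj₂ (∈-filter⁻ (λ x → T? (adj G v x)) {xs = allFin n} m))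

  nbrs-∋ : ∀ {v u} → adj G v u ≡ true → u ∈ nbrs v
  nbrs-∋ {v} {u} e = ∈-filter⁺ (λ x → T? (adj G v x)) (∈-allFin u) (≡⇒T e)

  ΣN-star : ∀ v (F : NbrType → ℕ) → ΣN G v (λ u → F (deg G u , saturated u)) ≡ sum (map F (star v))
  ΣN-star v F = sym (begin
      sum (map F (star v))
    ≡⟨ cong sum (sym (map-∘ (nbrs v))) ⟩
      sum (map (λ u → F (deg G u , saturated u)) (nbrs v))
    ≡⟨ sum-filter (adj G v) _ (allFin n) ⟩
      sum (map (λ u → ind (adj G v u) * F (deg G u , saturated u)) (allFin n))
    ≡⟨ ∑-allFin n _ ⟩
      ΣN G v (λ u → F (deg G u , saturated u))
    ∎)
    where open ≡-Reasoning

  star-length : ∀ v → length (star v) ≡ deg G v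
  star-length v = length-map _ (nbrs v)

  star-saturated : ∀ v → Star.saturated (deg G v) (star v) ≡ saturated v
  star-saturated v = cong (λ l → deg G v ≤ᵇ l + 1) (sym (ΣN-star v (λ p → ind (isLeaf (proj₁ p)))))

  star-spend : ∀ v → Star.spend (deg G v) (star v) ≡ spend v
  star-spend v = sym (ΣN-star v (λ p → share (deg G v) (proj₁ p) + pay (deg G v) (proj₁ p) (proj₂ p)))

  star-budget : ∀ v → Star.budget (deg G v) (star v) ≡ budget v
  star-budget v = cong (28 * (deg G v ∸ 1) +_)
    (trans (cong (λ s → sum (map (λ p → pay (proj₁ p) (deg G v) s) (star v))) (star-saturated v))
           (sym (ΣN-star v (λ p → pay (proj₁ p) (deg G v) (saturated v)))))

Exceptional : ∀ {n} → Graph n → Fin n → Set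
Exceptional G v = deg G v ≡ 2 ⊎ deg G v ≡ 3

module Balance {n : ℕ} (G : Graph n) (conn : Connected G) (chem : IsChemical G) (n≥7 : 7 ≤ n) where

  saturated-nbr : ∀ v u w → adj G v u ≡ true → 2 ≤ deg G v → saturated G u ≡ true →
                  adj G u w ≡ true → w ≢ v → deg G w ≡ 1
  saturated-nbr v u w vu dv sat uw w≢v with isLeaf (deg G w) in ew
  ... | true = ≡ᵇ⇒≡ (deg G w) 1 (≡⇒T ew)
  ... | false = ⊥-elim (<⇒≱ too-many (≤ᵇ⇒≤ _ _ (≡⇒T sat)))
    where
    nonLeafNbrs : ℕ
    nonLeafNbrs = ΣN G u (λ x → ind (not (isLeaf (deg G x))))
    split : deg G u ≡ leafNbrs G u + nonLeafNbrs
    split = trans (deg≡ΣN G u) (trans (sum-cong-≗ {n} by-leafness)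
                                      (ΣN-+ G u (λ x → ind (isLeaf (deg G x))) (λ x → ind (not (isLeaf (deg G x))))))
      where
      by-leafness : ∀ x → ind (adj G u x) * 1 ≡ ind (adj G u x) * (ind (isLeaf (deg G x)) + ind (not (isLeaf (deg G x))))
      by-leafness x with adj G u x | isLeaf (deg G x)
      ... | true | true = refl
      ... | true | false = refl
      ... | false | _ = refl
    v-non-leaf : isLeaf (deg G v) ≡ false
    v-non-leaf with isLeaf (deg G v) in e
    ... | false = refl
    ... | true = ⊥-elim (<-irrefl refl (subst (2 ≤_) (≡ᵇ⇒≡ (deg G v) 1 (≡⇒T e)) dv))
    two : 2 ≤ nonLeafNbrs
    two = subst (_≤ nonLeafNbrs) v-and-w (∑-≥-pair (λ x → ind (adj G u x) * ind (not (isLeaf (deg G x)))) (w≢v ∘′ sym))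
      where
      v-and-w : ind (adj G u v) * ind (not (isLeaf (deg G v))) + ind (adj G u w) * ind (not (isLeaf (deg G w))) ≡ 2
      v-and-w rewrite adj-sym G vu | v-non-leaf | uw | ew = refl
    too-many : leafNbrs G u + 1 < deg G u
    too-many = subst (leafNbrs G u + 1 <_) (sym split) (subst (_≤ leafNbrs G u + nonLeafNbrs) (+-suc _ 1) (+-monoʳ-≤ _ two))

  -- A star all of whose vertices are pendent or saturated would make the
  -- graph its own 2-ball, of at most 6 vertices.
  not-tiny : ∀ v → Star.tiny (deg G v) (star G v) ≡ false
  not-tiny v with Star.tiny (deg G v) (star G v) in e
  ... | false = refl
  ... | true = ⊥-elim (<⇒≱ (s≤s (≤ᵇ⇒≤ _ 6 (proj₂ parts)))
                      (≤-trans n≥7 (subst (n ≤_) (cong suc (ΣN-star G v proj₁)) (ball-bound G conn v far-pendent))))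
    where
    parts : T (all (λ p → isLeaf (proj₁ p) ∨ (proj₂ p ∧ (2 ≤ᵇ deg G v))) (star G v)) × T (1 + sum (map proj₁ (star G v)) ≤ᵇ 6)
    parts = T-split (≡⇒T e)
    nbr-ok : ∀ u → adj G v u ≡ true → T (isLeaf (deg G u) ∨ (saturated G u ∧ (2 ≤ᵇ deg G v)))
    nbr-ok u vu = All.lookup (all⁺ _ (star G v) (proj₁ parts)) (∈-map⁺ _ (nbrs-∋ G vu))
    far-pendent : ∀ u w → adj G v u ≡ true → adj G u w ≡ true → w ≢ v → deg G w ≡ 1
    far-pendent u w vu uw w≢v with T-∨ (nbr-ok u vu)
    ... | inj₁ leaf = ⊥-elim (w≢v (pendent-unique G (≡ᵇ⇒≡ (deg G u) 1 leaf) uw (adj-sym G vu)))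
    ... | inj₂ sat = let (s , d) = T-split sat in saturated-nbr v u w vu (≤ᵇ⇒≤ 2 _ d) (T⇒≡ s) uw w≢v

  star-chemical : ∀ v → All ChemicalType (star G v)
  star-chemical v = All-map⁺ (All.tabulate (λ m → adj⇒deg≥1 G (∈-nbrs G m) , chem _))

  vertex-fair : ∀ v → T (fairness (deg G v) (spend G v) (budget G v) (all (λ p → is14 (proj₁ p)) (star G v)) (saturated G v))
  vertex-fair v =
    subst₂ (λ sp bu → T (fairness (deg G v) sp bu a14 (saturated G v))) (star-spend G v) (star-budget G v)
      (subst (λ sat → T (fairness (deg G v) (Star.spend (deg G v) (star G v)) (Star.budget (deg G v) (star G v)) a14 sat))
             (star-saturated G v)
             (drop-tiny (subst (λ k → T (Star.balanced k (star G v))) (star-length G v)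
                        (star-balanced (star G v) (subst (_≤ 4) (sym (star-length G v)) (chem v)) (star-chemical v)))))
    where
    a14 : Bool
    a14 = all (λ p → is14 (proj₁ p)) (star G v)
    drop-tiny : ∀ {b} → T (Star.tiny (deg G v) (star G v) ∨ b) → T b
    drop-tiny t rewrite not-tiny v = t

  Deg14⇒is14 : ∀ {d} → d ≡ 1 ⊎ d ≡ 4 → is14 d ≡ true
  Deg14⇒is14 (inj₁ refl) = refl
  Deg14⇒is14 (inj₂ refl) = refl

  Exceptional⇒is14 : ∀ {v} → Exceptional G v → is14 (deg G v) ≡ false
  Exceptional⇒is14 (inj₁ e) rewrite e = refl
  Exceptional⇒is14 (inj₂ e) rewrite e = refl

  module AtVertex (v : Fin n) =
    Fair {deg G v} {spend G v} {budget G v} {all (λ p → is14 (proj₁ p)) (star G v)} {saturated G v} (vertex-fair v)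

  spend≤budget : ∀ v → spend G v ≤ budget G v
  spend≤budget v = AtVertex.spend≤budget v

  charge-regular : ∀ v → Deg14 G v → charge G v ≡ 0
  charge-regular v d = AtVertex.regular v (Deg14⇒is14 d)

  charge-exceptional : ∀ v → Exceptional G v → 2 ≤ charge G v
  charge-exceptional v ex = AtVertex.exceptional v (Exceptional⇒is14 ex)

  charge-lone : ∀ v → Exceptional G v → (∀ u → adj G v u ≡ true → Deg14 G u) → (charge G v ≤ 2 ⇔ saturated G v ≡ true)
  charge-lone v ex nbrs14 = AtVertex.lone v (Exceptional⇒is14 ex)
    (T⇒≡ (all⁻ _ (All-map⁺ (All.tabulate (λ m → ≡⇒T (Deg14⇒is14 (nbrs14 _ (∈-nbrs G m))))))))

module Identity {n : ℕ} (G : Graph n) (CT : IsChemicalTree G) (n≥7 : 7 ≤ n) where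
  open Balance G (proj₁ (proj₁ CT)) (proj₂ CT) n≥7

  S D P : ℕ
  -- S = ZC₁*(G), D = Σ d_v = 2(n − 1), P = total paid in gifts
  S = ∑[ v < n ] ΣN G v (λ u → deg G v * (deg G u ∸ 1))
  D = ∑ (deg G)
  P = ∑[ v < n ] ΣN G v (λ u → pay (deg G v) (deg G u) (saturated G u))

  zagreb≡S : ZC1* G ≡ S
  zagreb≡S = zagreb-edge-sum G (tree-no-triangle (proj₁ CT)) (tree-no-four-cycle (proj₁ CT))

  -- the shares of both ends of each edge add up to its weight plus 18
  share-total : ∑[ v < n ] ΣN G v (λ u → share (deg G v) (deg G u)) ≡ S + 9 * D
  share-total = *-cancelˡ-≡ _ _ 2 (begin
      2 * ∑[ v < n ] ΣN G v (share′ v)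
    ≡⟨ ΣN-symmetrize G share′ ⟨
      ∑[ v < n ] ΣN G v (λ u → share′ v u + share′ u v)
    ≡⟨ sum-cong-≗ (λ v → sum-cong-≗ (both-ends v)) ⟩
      ∑[ v < n ] ΣN G v (λ u → (W v u + W u v) + 18)
    ≡⟨ sum-cong-≗ (λ v → ΣN-+ G v (λ u → W v u + W u v) (λ _ → 18)) ⟩
      ∑[ v < n ] (ΣN G v (λ u → W v u + W u v) + ΣN G v (λ _ → 18))
    ≡⟨ ∑-distrib-+ (λ v → ΣN G v (λ u → W v u + W u v)) (λ v → ΣN G v (λ _ → 18)) ⟩
      ∑[ v < n ] ΣN G v (λ u → W v u + W u v) + ∑[ v < n ] ΣN G v (λ _ → 18)
    ≡⟨ cong₂ _+_ (ΣN-symmetrize G W)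
                 (trans (sum-cong-≗ (λ v → ΣN-const G v 18)) (sym (*-distribʳ-sum 18 (deg G)))) ⟩
      2 * S + D * 18
    ≡⟨ solve 2 (λ s d → con 2 :* s :+ d :* con 18 := con 2 :* (s :+ con 9 :* d)) refl S D ⟩
      2 * (S + 9 * D)
    ∎)
    where
    open ≡-Reasoning
    open +-*-Solver
    share′ W : Fin n → Fin n → ℕ
    share′ v u = share (deg G v) (deg G u)
    W v u = deg G v * (deg G u ∸ 1)
    both-ends : ∀ v u → ind (adj G v u) * (share′ v u + share′ u v) ≡ ind (adj G v u) * ((W v u + W u v) + 18)
    both-ends v u with adj G v u in e
    ... | false = refl
    ... | true = cong (λ x → x + 0)
                   (share-split (deg G v) (deg G u) (adj⇒deg≥1 G (adj-sym G e)) (proj₂ CT v) (adj⇒deg≥1 G e) (proj₂ CT u))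

  E C : ℕ
  E = ∑[ v < n ] (deg G v ∸ 1)
  C = total-charge G

  spend-total : ∑ (spend G) ≡ (S + 9 * D) + P
  spend-total = trans (sum-cong-≗ (λ v → ΣN-+ G v (λ u → share (deg G v) (deg G u)) (paid v)))
    (trans (∑-distrib-+ (λ v → ΣN G v (λ u → share (deg G v) (deg G u))) (λ v → ΣN G v (paid v)))
           (cong (_+ P) share-total))
    where
    paid : Fin n → Fin n → ℕ
    paid v u = pay (deg G v) (deg G u) (saturated G u)

  -- every gift paid is received
  budget-total : ∑ (budget G) ≡ 28 * E + P
  budget-total = trans (∑-distrib-+ (λ v → 28 * (deg G v ∸ 1)) (received G))
    (cong₂ _+_ (sym (*-distribˡ-sum 28 (λ v → deg G v ∸ 1))) (sym (ΣN-swap G (λ v u → pay (deg G v) (deg G u) (saturated G u)))))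

  spend+charge : ∑ (spend G) + C ≡ ∑ (budget G)
  spend+charge = trans (sym (∑-distrib-+ (spend G) (charge G))) (sum-cong-≗ (λ v → m+[n∸m]≡n (spend≤budget v)))

  E+n≡D : E + n ≡ D
  E+n≡D = trans (cong (E +_) (sym (∑-ones n)))
    (trans (sym (∑-distrib-+ (λ v → deg G v ∸ 1) (λ _ → 1)))
           (sum-cong-≗ (λ v → m∸n+n≡m (connected⇒deg≥1 G (proj₁ (proj₁ CT)) (≤-trans (s≤s (s≤s z≤n)) n≥7) v))))

  D+2≡2n : D + 2 ≡ 2 * n
  D+2≡2n = trans (cong (_+ 2) (sym (∑-allFin n (deg G)))) (proj₂ (proj₁ CT))

  S+9D+C≡28E : S + 9 * D + C ≡ 28 * E
  S+9D+C≡28E = +-cancelʳ-≡ P _ _ (begin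
      S + 9 * D + C + P
    ≡⟨ solve 4 (λ s d c p → s :+ con 9 :* d :+ c :+ p := (s :+ con 9 :* d) :+ p :+ c) refl S D C P ⟩
      (S + 9 * D) + P + C
    ≡⟨ cong (_+ C) spend-total ⟨
      ∑ (spend G) + C
    ≡⟨ spend+charge ⟩
      ∑ (budget G)
    ≡⟨ budget-total ⟩
      28 * E + P
    ∎)
    where
    open ≡-Reasoning
    open +-*-Solver

  charge-identity : ZC1* G + C + 38 ≡ 10 * n
  charge-identity = +-cancelʳ-≡ (28 * n + 9 * D) _ _ (begin
      ZC1* G + C + 38 + (28 * n + 9 * D)
    ≡⟨ cong (λ z → z + C + 38 + (28 * n + 9 * D)) zagreb≡S ⟩
      S + C + 38 + (28 * n + 9 * D)
    ≡⟨ solve 4 (λ s c m d → s :+ c :+ con 38 :+ (con 28 :* m :+ con 9 :* d) := (s :+ con 9 :* d :+ c) :+ con 28 :* m :+ con 38) refl S C n D ⟩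
      (S + 9 * D + C) + 28 * n + 38
    ≡⟨ cong (λ z → z + 28 * n + 38) S+9D+C≡28E ⟩
      28 * E + 28 * n + 38
    ≡⟨ cong (λ z → z + 38) (trans (sym (*-distribˡ-+ 28 E n)) (cong (28 *_) E+n≡D)) ⟩
      28 * D + 38
    ≡⟨ solve 1 (λ d → con 28 :* d :+ con 38 := con 19 :* (d :+ con 2) :+ con 9 :* d) refl D ⟩
      19 * (D + 2) + 9 * D
    ≡⟨ cong (λ z → 19 * z + 9 * D) D+2≡2n ⟩
      19 * (2 * n) + 9 * D
    ≡⟨ solve 2 (λ m d → con 19 :* (con 2 :* m) :+ con 9 :* d := con 10 :* m :+ (con 28 :* m :+ con 9 :* d)) refl n D ⟩
      10 * n + (28 * n + 9 * D)
    ∎)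
    where
    open ≡-Reasoning
    open +-*-Solver

-- Degrees modulo 3.  In a tree Σ (d_v − 1) = n − 2, and a degree-4 vertex
-- contributes 3, so only the vertices of degree 2 or 3 affect n mod 3.
tree-residue : ∀ {n} (G : Graph n) → IsTree G → (c : ℕ) (f : Fin n → ℕ) →
  (∀ v → deg G v ≡ 1 + ind (deg G v ≡ᵇ 4) * 3 + f v) → ∑ f ≡ c → n % 3 ≡ (c + 2) % 3
tree-residue {n} G (_ , sumdeg) c f shape total =
  trans (cong (_% 3) (sym n≡)) (trans (cong (_% 3) (+-comm (k * 3) (c + 2))) ([m+kn]%n≡m%n (c + 2) k 3))
  where
  k : ℕ
  k = ∑[ v < n ] ind (deg G v ≡ᵇ 4)
  D≡ : ∑ (deg G) ≡ n + k * 3 + c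
  D≡ = trans (sum-cong-≗ shape)
    (trans (∑-distrib-+ (λ v → 1 + ind (deg G v ≡ᵇ 4) * 3) f)
           (cong₂ _+_ (trans (∑-distrib-+ (λ _ → 1) (λ v → ind (deg G v ≡ᵇ 4) * 3))
                             (cong₂ _+_ (∑-ones n) (sym (*-distribʳ-sum 3 (λ v → ind (deg G v ≡ᵇ 4))))))
                      total))
  n≡ : k * 3 + (c + 2) ≡ n
  n≡ = +-cancelˡ-≡ n _ _ (begin
      n + (k * 3 + (c + 2))
    ≡⟨ solve 3 (λ a b d → a :+ (b :+ (d :+ con 2)) := a :+ b :+ d :+ con 2) refl n (k * 3) c ⟩
      n + k * 3 + c + 2
    ≡⟨ cong (_+ 2) (sym D≡) ⟩
      ∑ (deg G) + 2
    ≡⟨ trans (cong (_+ 2) (sym (∑-allFin n (deg G)))) sumdeg ⟩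
      2 * n
    ≡⟨ cong (n +_) (+-identityʳ n) ⟩
      n + n
    ∎)
    where
    open ≡-Reasoning
    open +-*-Solver

all-regular-residue : ∀ {n} (G : Graph n) → IsTree G → (∀ v → Deg14 G v) → n % 3 ≡ 2
all-regular-residue {n} G T regular = tree-residue G T 0 (λ _ → 0) shape (∑-zero n)
  where
  shape : ∀ v → deg G v ≡ 1 + ind (deg G v ≡ᵇ 4) * 3 + 0
  shape v with regular v
  ... | inj₁ e rewrite e = refl
  ... | inj₂ e rewrite e = refl

one-exceptional-residue : ∀ {n} (G : Graph n) → IsTree G → (x : Fin n) (c : ℕ) → deg G x ≡ suc c →
  Exceptional G x → (∀ v → v ≢ x → Deg14 G v) → n % 3 ≡ (c + 2) % 3
one-exceptional-residue {n} G T x c dx exc others = tree-residue G T c (λ v → ind (same v x) * c) shape (∑-single x (λ _ → c))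
  where
  not4 : ∀ {d} → d ≡ 2 ⊎ d ≡ 3 → (d ≡ᵇ 4) ≡ false
  not4 (inj₁ refl) = refl
  not4 (inj₂ refl) = refl
  shape : ∀ v → deg G v ≡ 1 + ind (deg G v ≡ᵇ 4) * 3 + ind (same v x) * c
  shape v with same v x in e
  ... | true rewrite same⇒≡ {i = v} e | not4 exc = trans dx (cong suc (sym (+-identityʳ c)))
  ... | false with others v (same-false⇒≢ e)
  ...   | inj₁ d rewrite d = refl
  ...   | inj₂ d rewrite d = refl

module _ {n : ℕ} (G : Graph n) where

  OnePendentNbr TwoPendentNbrs : Fin n → Set
  OnePendentNbr x = Σ (Fin n) λ y → adj G x y ≡ true × Pendent G y
  TwoPendentNbrs x = Σ (Fin n) λ y → Σ (Fin n) λ z → ¬ (y ≡ z) × adj G x y ≡ true × adj G x z ≡ true × Pendent G y × Pendent G z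

  OthersRegular : Fin n → Set
  OthersRegular x = ∀ v → ¬ (v ≡ x) → Deg14 G v

  data CT*-Shape : Set where
    all-regular : n % 3 ≡ 2 → (∀ v → Deg14 G v) → CT*-Shape
    hub-2 : (x : Fin n) → deg G x ≡ 2 → OnePendentNbr x → OthersRegular x → CT*-Shape
    hub-3 : (x : Fin n) → deg G x ≡ 3 → TwoPendentNbrs x → OthersRegular x → CT*-Shape

  CT*-shape : InCT* G → CT*-Shape
  CT*-shape c with n % 3 in e
  ... | 0 = let (x , d , y , h) = c in hub-2 x d y h
  ... | 1 = let (x , d , y , h) = c in hub-3 x d y h
  ... | suc (suc k) = all-regular (trans e (cong (λ z → suc (suc z)) (k≡0 k (subst (_< 3) e (m%n<n n 3))))) c
    where
    k≡0 : ∀ k → suc (suc k) < 3 → k ≡ 0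
    k≡0 zero _ = refl
    k≡0 (suc k) (s≤s (s≤s (s≤s ())))

  all-regular-CT* : n % 3 ≡ 2 → (∀ v → Deg14 G v) → InCT* G
  all-regular-CT* e h with n % 3
  all-regular-CT* refl h | .2 = h

  hub-2-CT* : n % 3 ≡ 0 → (x : Fin n) → deg G x ≡ 2 → OnePendentNbr x → OthersRegular x → InCT* G
  hub-2-CT* e x d y h with n % 3
  hub-2-CT* refl x d y h | .0 = x , d , y , h

  hub-3-CT* : n % 3 ≡ 1 → (x : Fin n) → deg G x ≡ 3 → TwoPendentNbrs x → OthersRegular x → InCT* G
  hub-3-CT* e x d y h with n % 3
  hub-3-CT* refl x d y h | .1 = x , d , y , h

  leaf-term : ∀ x w → 1 ≤ ind (adj G x w) * ind (isLeaf (deg G w)) → adj G x w ≡ true × Pendent G w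
  leaf-term x w t with adj G x w | isLeaf (deg G w) in e
  ... | true | true = refl , ≡ᵇ⇒≡ (deg G w) 1 (≡⇒T e)

  pendent-term : ∀ {x w} → adj G x w ≡ true → Pendent G w → ind (adj G x w) * ind (isLeaf (deg G w)) ≡ 1
  pendent-term a p rewrite a | p = refl

  saturated⇔ : ∀ x c → deg G x ≡ suc c → (saturated G x ≡ true ⇔ c ≤ leafNbrs G x)
  saturated⇔ x c d = mk⇔
    (λ s → ≤-pred (subst₂ _≤_ d (+-comm (leafNbrs G x) 1) (≤ᵇ⇒≤ _ _ (≡⇒T s))))
    (λ le → T⇒≡ (≤⇒≤ᵇ (subst₂ _≤_ (sym d) (+-comm 1 (leafNbrs G x)) (s≤s le))))

  saturated⇒OnePendentNbr : ∀ x → deg G x ≡ 2 → saturated G x ≡ true → OnePendentNbr x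
  saturated⇒OnePendentNbr x d s =
    let (y , t) = ∑-pos _ (Equivalence.to (saturated⇔ x 1 d) s) in y , leaf-term x y t

  OnePendentNbr⇒saturated : ∀ x → deg G x ≡ 2 → OnePendentNbr x → saturated G x ≡ true
  OnePendentNbr⇒saturated x d (y , a , p) = Equivalence.from (saturated⇔ x 1 d)
    (subst (_≤ leafNbrs G x) (pendent-term a p) (∑-≥-term y (λ w → ind (adj G x w) * ind (isLeaf (deg G w)))))

  saturated⇒TwoPendentNbrs : ∀ x → deg G x ≡ 3 → saturated G x ≡ true → TwoPendentNbrs x
  saturated⇒TwoPendentNbrs x d s =
    let (y , z , y≢z , ty , tz) = ∑-two _ (λ w → leaf-term≤1 w) (Equivalence.to (saturated⇔ x 2 d) s)
        (ay , py) = leaf-term x y ty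
        (az , pz) = leaf-term x z tz
    in y , z , y≢z , ay , az , py , pz
    where
    leaf-term≤1 : ∀ w → ind (adj G x w) * ind (isLeaf (deg G w)) ≤ 1
    leaf-term≤1 w rewrite ind-∧ (adj G x w) (isLeaf (deg G w)) = ind≤1 _

  TwoPendentNbrs⇒saturated : ∀ x → deg G x ≡ 3 → TwoPendentNbrs x → saturated G x ≡ true
  TwoPendentNbrs⇒saturated x d (y , z , y≢z , ay , az , py , pz) = Equivalence.from (saturated⇔ x 2 d)
    (subst (_≤ leafNbrs G x) (cong₂ _+_ (pendent-term ay py) (pendent-term az pz))
           (∑-≥-pair (λ w → ind (adj G x w) * ind (isLeaf (deg G w))) y≢z))

deficit : ℕ → ℕ
deficit n = if n % 3 ≡ᵇ 2 then 0 else 2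

module Classify {n : ℕ} (G : Graph n) (CT : IsChemicalTree G) (n≥7 : 7 ≤ n) where
  open Balance G (proj₁ (proj₁ CT)) (proj₂ CT) n≥7
  open Identity G CT n≥7 using (C)

  regular-or-exceptional : ∀ v → Deg14 G v ⊎ Exceptional G v
  regular-or-exceptional v
    with degree-onto (deg G v) (connected⇒deg≥1 G (proj₁ (proj₁ CT)) (≤-trans (s≤s (s≤s z≤n)) n≥7) v) (proj₂ CT v)
  ... | zero , d = inj₁ (inj₁ d)
  ... | suc zero , d = inj₂ (inj₁ d)
  ... | suc (suc zero) , d = inj₂ (inj₂ d)
  ... | suc (suc (suc zero)) , d = inj₁ (inj₂ d)

  others-regular : C ≤ 2 → ∀ x → Exceptional G x → OthersRegular G x
  others-regular C≤2 x ex v v≢x with regular-or-exceptional v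
  ... | inj₁ r = r
  ... | inj₂ ev = ⊥-elim (4≰2 (≤-trans (+-mono-≤ (charge-exceptional x ex) (charge-exceptional v ev))
                                      (≤-trans (∑-≥-pair {x = x} {y = v} (charge G) (v≢x ∘′ sym)) C≤2)))
    where
    4≰2 : ¬ (4 ≤ 2)
    4≰2 (s≤s (s≤s ()))

  C≡charge : ∀ x → OthersRegular G x → C ≡ charge G x
  C≡charge x others = trans (sum-cong-≗ only-x) (∑-single x (charge G))
    where
    only-x : ∀ v → charge G v ≡ ind (same v x) * charge G v
    only-x v with same v x in e
    ... | true = sym (+-identityʳ _)
    ... | false = charge-regular v (others v (same-false⇒≢ e))

  lone : ∀ x → Exceptional G x → OthersRegular G x → (charge G x ≤ 2 ⇔ saturated G x ≡ true)
  lone x ex others = charge-lone x ex (λ u a → others u (adj⇒≢ G a ∘′ sym))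

  exceptional-deficit : ∀ x → Exceptional G x → OthersRegular G x → deficit n ≡ 2
  exceptional-deficit x (inj₁ d) others =
    cong (λ r → if r ≡ᵇ 2 then 0 else 2) (one-exceptional-residue G (proj₁ CT) x 1 d (inj₁ d) others)
  exceptional-deficit x (inj₂ d) others =
    cong (λ r → if r ≡ᵇ 2 then 0 else 2) (one-exceptional-residue G (proj₁ CT) x 2 d (inj₂ d) others)

  deficit≤C : deficit n ≤ C
  deficit≤C with n % 3 ≡ᵇ 2 in e
  ... | true = z≤n
  ... | false with all-or-some regular-or-exceptional
  ...   | inj₁ regular = ⊥-elim (true≢false (trans (sym (cong (_≡ᵇ 2) (all-regular-residue G (proj₁ CT) regular))) e))
  ...   | inj₂ (x , ex) = ≤-trans (charge-exceptional x ex) (∑-≥-term x (charge G))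

  CT*⇒C≤deficit : InCT* G → C ≤ deficit n
  CT*⇒C≤deficit c with CT*-shape G c
  ... | all-regular _ regular = subst (_≤ deficit n) (sym (trans (sum-cong-≗ (λ v → charge-regular v (regular v))) (∑-zero n))) z≤n
  ... | hub-2 x d pend others = subst₂ _≤_ (sym (C≡charge x others)) (sym (exceptional-deficit x (inj₁ d) others))
          (Equivalence.from (lone x (inj₁ d) others) (OnePendentNbr⇒saturated G x d pend))
  ... | hub-3 x d pend others = subst₂ _≤_ (sym (C≡charge x others)) (sym (exceptional-deficit x (inj₂ d) others))
          (Equivalence.from (lone x (inj₂ d) others) (TwoPendentNbrs⇒saturated G x d pend))

  C≤deficit⇒CT* : C ≤ deficit n → InCT* G
  C≤deficit⇒CT* C≤e with all-or-some regular-or-exceptional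
  ... | inj₁ regular = all-regular-CT* G (all-regular-residue G (proj₁ CT) regular) regular
  ... | inj₂ (x , ex) = by-degree ex
    where
    others : OthersRegular G x
    others = others-regular (≤-trans C≤e (deficit≤2 n)) x ex
      where
      deficit≤2 : ∀ m → deficit m ≤ 2
      deficit≤2 m with m % 3 ≡ᵇ 2
      ... | true = z≤n
      ... | false = ≤-refl
    sat : saturated G x ≡ true
    sat = Equivalence.to (lone x ex others)
      (subst₂ _≤_ (C≡charge x others) (exceptional-deficit x ex others) C≤e)
    by-degree : Exceptional G x → InCT* G
    by-degree (inj₁ d) = hub-2-CT* G (one-exceptional-residue G (proj₁ CT) x 1 d (inj₁ d) others)
                                   x d (saturated⇒OnePendentNbr G x d sat) others
    by-degree (inj₂ d) = hub-3-CT* G (one-exceptional-residue G (proj₁ CT) x 2 d (inj₂ d) others)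
                                   x d (saturated⇒TwoPendentNbrs G x d sat) others

-- Attaching a new pendent vertex (numbered 0) to the vertex a.
attach-adj : ∀ {n} → Graph n → Fin n → Fin (suc n) → Fin (suc n) → Bool
attach-adj G a zero zero = false
attach-adj G a zero (suc j) = same j a
attach-adj G a (suc i) zero = same i a
attach-adj G a (suc i) (suc j) = adj G i j

attach : ∀ {n} → Graph n → Fin n → Graph (suc n)
attach G a = record { adj = attach-adj G a ; sym = symmetric ; irrefl = irreflexive }
  where
  symmetric : ∀ u v → attach-adj G a u v ≡ attach-adj G a v u
  symmetric zero zero = refl
  symmetric zero (suc j) = refl
  symmetric (suc i) zero = refl
  symmetric (suc i) (suc j) = Graph.sym G i j
  irreflexive : ∀ v → attach-adj G a v v ≡ false
  irreflexive zero = refl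
  irreflexive (suc i) = irrefl G i

module Attach {n : ℕ} (G : Graph n) (a : Fin n) where
  private
    L : Graph (suc n)
    L = attach G a

  deg-new : deg L zero ≡ 1
  deg-new = trans (deg≡ΣN L zero) (∑-single a (λ _ → 1))

  deg-old : ∀ i → deg L (suc i) ≡ ind (same i a) + deg G i
  deg-old i = trans (count≡∑ (adj L (suc i))) (cong (ind (same i a) +_) (sym (count≡∑ (adj G i))))

  deg-other : ∀ i → i ≢ a → deg L (suc i) ≡ deg G i
  deg-other i ne = trans (deg-old i) (cong (λ b → ind b + deg G i) (≢⇒same ne))

  deg-anchor : deg L (suc a) ≡ suc (deg G a)
  deg-anchor = trans (deg-old a) (cong (λ b → ind b + deg G a) (same-refl a))

  lift : ∀ {i j} → Reach G i j → Reach L (suc i) (suc j)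
  lift here = here
  lift (step e r) = step e (lift r)

  _++ᴿ_ : ∀ {H : Graph (suc n)} {u v w} → Reach H u v → Reach H v w → Reach H u w
  here ++ᴿ q = q
  step e p ++ᴿ q = step e (p ++ᴿ q)

  tree : IsTree G → IsTree L
  tree (conn , sumdeg) = conn′ , (begin
      sumDeg L + 2
    ≡⟨ cong (_+ 2) (∑-allFin (suc n) (deg L)) ⟩
      deg L zero + ∑[ i < n ] deg L (suc i) + 2
    ≡⟨ cong (λ z → z + 2) (cong₂ _+_ deg-new (trans (sum-cong-≗ deg-old) (∑-distrib-+ (λ i → ind (same i a)) (deg G)))) ⟩
      1 + (∑[ i < n ] ind (same i a) + ∑ (deg G)) + 2
    ≡⟨ cong (λ z → 1 + (z + ∑ (deg G)) + 2) (trans (sum-cong-≗ {n} (λ i → sym (*-identityʳ _))) (∑-single a (λ _ → 1))) ⟩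
      2 + ∑ (deg G) + 2
    ≡⟨ cong (λ z → 2 + z + 2) (sym (∑-allFin n (deg G))) ⟩
      2 + sumDeg G + 2
    ≡⟨ +-assoc 2 (sumDeg G) 2 ⟩
      2 + (sumDeg G + 2)
    ≡⟨ cong (2 +_) sumdeg ⟩
      2 + 2 * n
    ≡⟨ *-distribˡ-+ 2 1 n ⟨
      2 * suc n
    ∎)
    where
    open ≡-Reasoning
    conn′ : Connected L
    conn′ zero zero = here
    conn′ zero (suc j) = step (same-refl a) (lift (conn a j))
    conn′ (suc i) zero = lift (conn i a) ++ᴿ step (same-refl a) here
    conn′ (suc i) (suc j) = lift (conn i j)

-- Extremal trees exist: starting from the star K₁,₄, repeatedly attach a
-- leaf at a "hub" vertex whose degree cycles through 1, 2, 3 (and then 4,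
-- when the new leaf becomes the hub), all other degrees being 1 or 4.
data Hub {m : ℕ} (H : Graph m) : Set where
  hub-deg1 : (h : Fin m) → deg H h ≡ 1 → OthersRegular H h → Hub H
  hub-deg2 : (h : Fin m) → deg H h ≡ 2 → OnePendentNbr H h → OthersRegular H h → Hub H
  hub-deg3 : (h : Fin m) → deg H h ≡ 3 → TwoPendentNbrs H h → OthersRegular H h → Hub H

HubTree : ℕ → Set
HubTree m = Σ (Graph m) λ H → IsTree H × Hub H

attach-keeps-regular : ∀ {m} (H : Graph m) (h : Fin m) → OthersRegular H h → ∀ i → i ≢ h → Deg14 (attach H h) (suc i)
attach-keeps-regular H h others i ne with others i ne
... | inj₁ d = inj₁ (trans (Attach.deg-other H h i ne) d)
... | inj₂ d = inj₂ (trans (Attach.deg-other H h i ne) d)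

grow : ∀ {m} → HubTree m → HubTree (suc m)
grow (H , T , hub-deg1 h d others) =
  attach H h , Attach.tree H h T , hub-deg2 (suc h) (trans (Attach.deg-anchor H h) (cong suc d)) (zero , same-refl h , Attach.deg-new H h) others′
  where
  others′ : OthersRegular (attach H h) (suc h)
  others′ zero _ = inj₁ (Attach.deg-new H h)
  others′ (suc i) ne = attach-keeps-regular H h others i (λ e → ne (cong suc e))
grow (H , T , hub-deg2 h d (y , hy , py) others) =
  attach H h , Attach.tree H h T ,
  hub-deg3 (suc h) (trans (Attach.deg-anchor H h) (cong suc d))
           (zero , suc y , (λ ()) , same-refl h , hy , Attach.deg-new H h , trans (Attach.deg-other H h y (adj⇒≢ H hy ∘′ sym)) py) others′
  where
  others′ : OthersRegular (attach H h) (suc h)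
  others′ zero _ = inj₁ (Attach.deg-new H h)
  others′ (suc i) ne = attach-keeps-regular H h others i (λ e → ne (cong suc e))
grow (H , T , hub-deg3 h d _ others) = attach H h , Attach.tree H h T , hub-deg1 zero (Attach.deg-new H h) others′
  where
  others′ : OthersRegular (attach H h) zero
  others′ zero ne = ⊥-elim (ne refl)
  others′ (suc i) _ with i ≟ h
  ... | yes refl = inj₂ (trans (Attach.deg-anchor H h) (cong suc d))
  ... | no ne = attach-keeps-regular H h others i ne

star₅ : Graph 5
star₅ = record { adj = centre ; sym = symmetric ; irrefl = irreflexive }
  where
  centre : Fin 5 → Fin 5 → Bool
  centre zero (suc _) = true
  centre (suc _) zero = true
  centre _ _ = false
  symmetric : ∀ u v → centre u v ≡ centre v u
  symmetric zero zero = refl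
  symmetric zero (suc j) = refl
  symmetric (suc i) zero = refl
  symmetric (suc i) (suc j) = refl
  irreflexive : ∀ v → centre v v ≡ false
  irreflexive zero = refl
  irreflexive (suc i) = refl

star₅-tree : HubTree 5
star₅-tree = star₅ , (connected , refl) , hub-deg1 (suc zero) refl others
  where
  connected : Connected star₅
  connected zero zero = here
  connected zero (suc j) = step refl here
  connected (suc i) zero = step refl here
  connected (suc i) (suc j) = step {v = zero} refl (step refl here)
  others : OthersRegular star₅ (suc zero)
  others zero _ = inj₂ refl
  others (suc i) _ = inj₁ refl

hub-trees : ∀ k → HubTree (5 + k)
hub-trees zero = star₅-tree
hub-trees (suc k) = grow (hub-trees k)

hub-chemical : ∀ {m} (H : Graph m) (h : Fin m) → deg H h ≤ 4 → OthersRegular H h → IsChemical H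
hub-chemical H h dh others v with v ≟ h
... | yes refl = dh
... | no ne with others v ne
...   | inj₁ e rewrite e = s≤s z≤n
...   | inj₂ e rewrite e = ≤-refl

hub-tree-extremal : ∀ {m} → HubTree m → Σ (Graph m) λ H → IsChemicalTree H × InCT* H
hub-tree-extremal (H , T , hub-deg1 h d others) =
  H , (T , hub-chemical H h (subst (_≤ 4) (sym d) (s≤s z≤n)) others) , all-regular-CT* H (all-regular-residue H T regular) regular
  where
  regular : ∀ v → Deg14 H v
  regular v with v ≟ h
  ... | yes refl = inj₁ d
  ... | no ne = others v ne
hub-tree-extremal (H , T , hub-deg2 h d pend others) =
  H , (T , hub-chemical H h (subst (_≤ 4) (sym d) (s≤s (s≤s z≤n))) others) ,
  hub-2-CT* H (one-exceptional-residue H T h 1 d (inj₁ d) others) h d pend others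
hub-tree-extremal (H , T , hub-deg3 h d pend others) =
  H , (T , hub-chemical H h (subst (_≤ 4) (sym d) (s≤s (s≤s (s≤s z≤n)))) others) ,
  hub-3-CT* H (one-exceptional-residue H T h 2 d (inj₂ d) others) h d pend others

extremal-tree : ∀ n → 5 ≤ n → Σ (Graph n) λ H → IsChemicalTree H × InCT* H
extremal-tree n 5≤n = subst (λ m → Σ (Graph m) λ H → IsChemicalTree H × InCT* H) (m+[n∸m]≡n 5≤n)
  (hub-tree-extremal (hub-trees (n ∸ 5)))

exchange-≤ : ∀ {a x c y} → a + x ≡ c + y → y ≤ x → a ≤ c
exchange-≤ {a} {x} {c} {y} eq y≤x = +-cancelʳ-≤ y a c (≤-trans (+-monoʳ-≤ a y≤x) (≤-reflexive eq))

exchange-≤′ : ∀ {x a y c} → x + a ≡ y + c → y ≤ x → a ≤ c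
exchange-≤′ {x} {a} {y} {c} eq = exchange-≤ (trans (+-comm a x) (trans eq (+-comm y c)))

zagreb+charge-invariant : ∀ {n} → 7 ≤ n → (T T′ : Graph n) → IsChemicalTree T → IsChemicalTree T′ →
                          ZC1* T + total-charge T ≡ ZC1* T′ + total-charge T′
zagreb+charge-invariant n≥7 T T′ CT CT′ =
  +-cancelʳ-≡ 38 _ _ (trans (Identity.charge-identity T CT n≥7) (sym (Identity.charge-identity T′ CT′ n≥7)))

theorem3p8 : (n : ℕ) → 7 ≤ n → (T* : Graph n) → IsChemicalTree T* →
    ((∀ (T : Graph n) → IsChemicalTree T → ZC1* T ≤ ZC1* T*) ⇔ InCT* T*)
theorem3p8 n n≥7 T* CT* = mk⇔ maximal⇒CT* CT*⇒maximal
  where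
  -- members of CT*_n have the least total charge, deficit n
  CT*⇒maximal : InCT* T* → ∀ T → IsChemicalTree T → ZC1* T ≤ ZC1* T*
  CT*⇒maximal c T CT = exchange-≤ (zagreb+charge-invariant n≥7 T T* CT CT*)
    (≤-trans (Classify.CT*⇒C≤deficit T* CT* n≥7 c) (Classify.deficit≤C T CT n≥7))
  -- compare with an extremal tree W ∈ CT*_n
  maximal⇒CT* : (∀ T → IsChemicalTree T → ZC1* T ≤ ZC1* T*) → InCT* T*
  maximal⇒CT* maximal with extremal-tree n (≤-trans (s≤s (s≤s (s≤s (s≤s (s≤s z≤n))))) n≥7)
  ... | W , CW , W∈CT* = Classify.C≤deficit⇒CT* T* CT* n≥7
    (≤-trans (exchange-≤′ (sym (zagreb+charge-invariant n≥7 W T* CW CT*)) (maximal W CW))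
             (Classify.CT*⇒C≤deficit W CW n≥7 W∈CT*))
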